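{- Let $s\ge0$ be an integer with $s=k(k+1)+i$ for integers $k\ge0$ and $0\le i\le 2k+1$. Define \[ (x^{even}_s,y^{even}_s)=\begin{cases}(i,\,2(k-i)),&0\le i\le k,\\ (i-k-1,\,4k-2i+3),&k+1\le i\le 2k+1,\end{cases}\qquad (x^{odd}_s,y^{odd}_s)=\begin{cases}(2i,\,k-i),&0\le i\le k,\\ (2(i-k)-1,\,2k-i+1),&k+1\le i\le 2k+1,\end{cases} \] and $N^{even}_s=6\lfloor\sqrt{s+1}\rfloor-6$, $N^{odd}_s=6\left\lfloor\frac{\sqrt{4s+5}-1}{2}\right\rfloor-3$. Let $n$ be a positive integer with $n>N^{even}_s$ if $n$ is even and $n>N^{odd}_s$ if $n$ is odd, and let $(x_s,y_s)=(x^{even}_s,y^{even}_s)$ if $n$ is even and $(x_s,y_s)=(x^{odd}_s,y^{odd}_s)$ if $n$ is odd. Let $t_m=\frac{m(m+1)}{2}$ and $d_1=\gcd(t_{n+1},t_{n+2})$. Then \[ \mathtt{g}\!\left(t_n,\frac{t_{n+1}}{d_1},\frac{t_{n+2}}{d_1};s\right)=\mathtt{g}\!\left(\frac{t_{n+1}}{d_1},\frac{t_{n+2}}{d_1};x_s\right)+y_s t_n=(x_s+1)\frac{t_{n+2}t_{n+1}}{d_1^2}-\frac{t_{n+2}}{d_1}-\frac{t_{n+1}}{d_1}+y_s t_n . \]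
   Context: For positive integers $a_1,\dots,a_k$ with $\gcd(a_1,\dots,a_k)=1$ and an integer $m$, $\operatorname{d}(m;a_1,\dots,a_k)$ denotes the number of tuples of non-negative integers $(x_1,\dots,x_k)$ with $a_1x_1+\dots+a_kx_k=m$ (zero if $m<0$). For an integer $s\ge0$, $\mathtt{g}(a_1,\dots,a_k;s)=\max\{m\in\mathbb{Z}:\operatorname{d}(m;a_1,\dots,a_k)\le s\}$ (generalized Frobenius number). -}

module Defs where

open import Data.Nat using (ℕ; zero; suc; _+_; _*_; _∸_; _≤_; _<_; _≤ᵇ_; _≡ᵇ_)
open import Data.Nat.DivMod using (_/_)
open import Data.Bool using (if_then_else_)
open import Data.List using (List; []; _∷_; map; upTo)
open import Data.Nat.ListAction using (sum)
open import Data.Integer using (ℤ; +_; -[1+_])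
import Data.Integer as ℤ
open import Data.Product using (_×_)

-- d(m; a₁,…,aₖ) for m ∈ ℕ: number of tuples (x₁,…,xₖ) ∈ ℕᵏ with Σ aⱼ xⱼ = m,
-- counted by recursion on the list: the first coefficient a contributes
-- x ∈ {0,…,m} with a*x ≤ m (all possible x when a ≥ 1).
repsℕ : List ℕ → ℕ → ℕ
repsℕ [] m = if m ≡ᵇ 0 then 1 else 0
repsℕ (a ∷ as) m =
  sum (map (λ x → if a * x ≤ᵇ m then repsℕ as (m ∸ a * x) else 0) (upTo (suc m)))

reps : List ℕ → ℤ → ℕ
reps as (+ m) = repsℕ as m
reps as -[1+ m ] = 0

-- m = g(a₁,…,aₖ; s), i.e. m is the maximum of { m ∈ ℤ : d(m) ≤ s }
IsGenFrob : List ℕ → ℕ → ℤ → Set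
IsGenFrob as s m = (reps as m ≤ s) × (∀ (m' : ℤ) → m ℤ.< m' → s < reps as m')

tri : ℕ → ℕ
tri m = (m * suc m) / 2

-- a / d for d ≠ 0 (returns 0 when d = 0; only used with d = gcd ≠ 0)
_÷_ : ℕ → ℕ → ℕ
a ÷ zero = 0
a ÷ suc d = a / suc d

IsFloorSqrt : ℕ → ℕ → Set
IsFloorSqrt r x = (r * r ≤ x) × (x < suc r * suc r)

-- r = ⌊(√x − 1)/2⌋ (for x ≥ 1), i.e. (2r+1)² ≤ x < (2r+3)²
IsFloorHalfSqrtMinus1 : ℕ → ℕ → Set
IsFloorHalfSqrtMinus1 r x = ((1 + 2 * r) * (1 + 2 * r) ≤ x) × (x < (3 + 2 * r) * (3 + 2 * r))

-- (x^even_s, y^even_s) with s = k(k+1)+i, 0 ≤ i ≤ 2k+1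
xEven yEven xOdd yOdd : ℕ → ℕ → ℕ
xEven k i = if i ≤ᵇ k then i else i ∸ k ∸ 1
yEven k i = if i ≤ᵇ k then 2 * (k ∸ i) else (4 * k + 3) ∸ 2 * i
xOdd k i = if i ≤ᵇ k then 2 * i else 2 * (i ∸ k) ∸ 1
yOdd k i = if i ≤ᵇ k then k ∸ i else (2 * k + 1) ∸ i

open import Data.Nat.DivMod using (_%_)
xS yS : ℕ → ℕ → ℕ → ℕ
xS n k i = if n % 2 ≡ᵇ 0 then xEven k i else xOdd k i
yS n k i = if n % 2 ≡ᵇ 0 then yEven k i else yOdd k i

{-# OPTIONS --safe #-}
-- Let a = t_n, b = t_{n+1}/d₁ and c = t_{n+2}/d₁.  Then b and c are coprime and a = q b, with
-- (q, b, c) = (M, 2M+1, 2M+3) for n = 2M and (2M+1, M+1, M+2) for n = 2M+1.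
--
-- For z < b the representations of b V + c z - b by (b, c) correspond to the multiples of c
-- below V, so there are ⌈V/c⌉ of them; peeling off multiples of a, the representations of
-- b (u q + e) + c z - b by (a, b, c) number Σ_{j ≤ u} ⌈(j q + e)/c⌉.  The count only grows in
-- steps of b, and every m above c (b - 1) - b has the form b V + c z - b with z < b, so
-- b W + c (b - 1) - b is g(a, b, c; s) as soon as W = u q + e makes this sum s while e + 1
-- makes it s + 1.
--
-- Take u = 2k or 2k + 1 (n even) or u = k (n odd), and e = 3i if i ≤ k, e = 3(i - k - 1)
-- (plus c for n odd) otherwise.  The lower bound on n makes 3k small against n/2, so every
-- ceiling is an explicit t + [3t < e] and the sum is k(k+1) + i.  Finally u q + e = x_s c + y_s q
-- turns b W + c (b - 1) - b into the claimed formula, and W = x_s c gives g(b, c; x_s).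
module Submission where

open import Defs
open import Data.Bool using (true; false; if_then_else_)
open import Data.Empty using (⊥-elim)
open import Data.List using (List; []; _∷_; map; applyUpTo)
open import Data.Nat
open import Data.Nat.Coprimality using (Coprime; coprime-Bézout; coprime-divisor; coprime-+; coprime⇒gcd≡1)
import Data.Nat.Coprimality as Coprimality
open import Data.Nat.Divisibility
open import Data.Nat.DivMod
open import Data.Nat.GCD using (gcd; c*gcd[m,n]≡gcd[cm,cn]; module Bézout)
open import Data.Nat.ListAction using (sum)
open import Data.Nat.Properties
open import Data.Nat.Tactic.RingSolver using (solve-∀)
open import Data.Product using (∃; ∃₂; _×_; _,_)
open import Function using (_∘_; id)
open import Relation.Binary.Definitions using (tri<; tri≈; tri>)
open import Relation.Binary.PropositionalEquality
open import Relation.Nullary using (¬_; yes; no)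
open import Relation.Nullary.Reflects using (ofʸ; ofⁿ)

∑< : ℕ → (ℕ → ℕ) → ℕ
∑< zero    f = 0
∑< (suc n) f = f 0 + ∑< n (f ∘ suc)

syntax ∑< n (λ x → e) = ∑[ x < n ] e

sum-map-applyUpTo : ∀ (g h : ℕ → ℕ) n → sum (map g (applyUpTo h n)) ≡ ∑< n (g ∘ h)
sum-map-applyUpTo g h zero    = refl
sum-map-applyUpTo g h (suc n) = cong (g (h 0) +_) (sum-map-applyUpTo g (h ∘ suc) n)

∑<-cong : ∀ n {f g : ℕ → ℕ} → (∀ x → x < n → f x ≡ g x) → ∑< n f ≡ ∑< n g
∑<-cong zero    eq = refl
∑<-cong (suc n) eq = cong₂ _+_ (eq 0 z<s) (∑<-cong n (λ x x<n → eq (suc x) (s<s x<n)))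

∑<-mono-≤ : ∀ n {f g : ℕ → ℕ} → (∀ x → x < n → f x ≤ g x) → ∑< n f ≤ ∑< n g
∑<-mono-≤ zero    le = z≤n
∑<-mono-≤ (suc n) le = +-mono-≤ (le 0 z<s) (∑<-mono-≤ n (λ x x<n → le (suc x) (s<s x<n)))

∑<-zero : ∀ n {f : ℕ → ℕ} → (∀ x → x < n → f x ≡ 0) → ∑< n f ≡ 0
∑<-zero zero    eq = refl
∑<-zero (suc n) eq = cong₂ _+_ (eq 0 z<s) (∑<-zero n (λ x x<n → eq (suc x) (s<s x<n)))

∑<-+ : ∀ m n (f : ℕ → ℕ) → ∑< (m + n) f ≡ ∑< m f + ∑[ x < n ] f (m + x)
∑<-+ zero    n f = refl
∑<-+ (suc m) n f = trans (cong (f 0 +_) (∑<-+ m n (f ∘ suc))) (sym (+-assoc (f 0) _ _))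

∑<-suc : ∀ n (f : ℕ → ℕ) → ∑< (suc n) f ≡ ∑< n f + f n
∑<-suc zero    f = +-comm (f 0) 0
∑<-suc (suc n) f = trans (cong (f 0 +_) (∑<-suc n (f ∘ suc))) (sym (+-assoc (f 0) _ _))

∑<-+-distrib : ∀ n (f g : ℕ → ℕ) → ∑[ t < n ] (f t + g t) ≡ ∑< n f + ∑< n g
∑<-+-distrib zero    f g = refl
∑<-+-distrib (suc n) f g = trans (cong (f 0 + g 0 +_) (∑<-+-distrib n (f ∘ suc) (g ∘ suc))) (lemma (f 0) (g 0) _ _)
  where
  lemma : ∀ a b c d → a + b + (c + d) ≡ a + c + (b + d)
  lemma = solve-∀

χ[_<_] : ℕ → ℕ → ℕ
χ[ _     < zero  ] = 0
χ[ zero  < suc _ ] = 1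
χ[ suc d < suc e ] = χ[ d < e ]

χ-< : ∀ {d e} → d < e → χ[ d < e ] ≡ 1
χ-< {zero}  {suc e} _         = refl
χ-< {suc d} {suc e} (s<s d<e) = χ-< d<e

χ-≥ : ∀ {d e} → e ≤ d → χ[ d < e ] ≡ 0
χ-≥ {d}     {zero}  _         = refl
χ-≥ {suc d} {suc e} (s≤s e≤d) = χ-≥ e≤d

χ-cong : ∀ {d e d′ e′} → (d < e → d′ < e′) → (d′ < e′ → d < e) → χ[ d < e ] ≡ χ[ d′ < e′ ]
χ-cong {d} {e} to from with d <? e
... | yes d<e = trans (χ-< d<e) (sym (χ-< (to d<e)))
... | no  d≮e = trans (χ-≥ (≮⇒≥ d≮e)) (sym (χ-≥ (≮⇒≥ (d≮e ∘ from))))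

χ-3* : ∀ t i → χ[ 3 * t < 3 * i ] ≡ χ[ t < i ]
χ-3* t i = χ-cong {3 * t} {3 * i} {t} {i} (*-cancelˡ-< 3 t i) (*-monoʳ-< 3)

χ-3*+1 : ∀ t i → χ[ 3 * t < suc (3 * i) ] ≡ χ[ t < suc i ]
χ-3*+1 t i = χ-cong {3 * t} {suc (3 * i)} {t} {suc i} (s≤s ∘ *-cancelˡ-≤ 3 ∘ ≤-pred) (s≤s ∘ *-monoʳ-≤ 3 ∘ ≤-pred)

∑<-χ : ∀ n i → i ≤ n → ∑[ t < n ] χ[ t < i ] ≡ i
∑<-χ n       zero    _         = ∑<-zero n (λ t _ → χ-≥ {t} z≤n)
∑<-χ (suc n) (suc i) (s≤s i≤n) = cong suc (∑<-χ n i i≤n)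

∑<-+χ : ∀ n i {f g : ℕ → ℕ} → i ≤ n → (∀ t → t < n → f t ≡ g t + χ[ t < i ]) → ∑< n f ≡ ∑< n g + i
∑<-+χ n i {f} {g} i≤n eq = begin
  ∑< n f                                   ≡⟨ ∑<-cong n eq ⟩
  ∑[ t < n ] (g t + χ[ t < i ])            ≡⟨ ∑<-+-distrib n g (λ t → χ[ t < i ]) ⟩
  ∑< n g + ∑[ t < n ] χ[ t < i ]           ≡⟨ cong (∑< n g +_) (∑<-χ n i i≤n) ⟩
  ∑< n g + i                               ∎
  where open ≡-Reasoning

∑<-double : ∀ n → ∑[ t < suc n ] (t + t) ≡ n * (n + 1)
∑<-double zero    = refl
∑<-double (suc n) = begin
  ∑[ t < suc (suc n) ] (t + t)              ≡⟨ ∑<-suc (suc n) (λ t → t + t) ⟩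
  ∑[ t < suc n ] (t + t) + (suc n + suc n)  ≡⟨ cong (_+ (suc n + suc n)) (∑<-double n) ⟩
  n * (n + 1) + (suc n + suc n)             ≡⟨ lemma n ⟩
  suc n * (suc n + 1)                       ∎
  where
  open ≡-Reasoning
  lemma : ∀ n → n * (n + 1) + (suc n + suc n) ≡ suc n * (suc n + 1)
  lemma = solve-∀

∑<-odd : ∀ n → ∑[ t < n ] suc (t + t) ≡ n * n
∑<-odd zero    = refl
∑<-odd (suc n) = begin
  ∑[ t < suc n ] suc (t + t)            ≡⟨ ∑<-suc n (λ t → suc (t + t)) ⟩
  ∑[ t < n ] suc (t + t) + suc (n + n)  ≡⟨ cong (_+ suc (n + n)) (∑<-odd n) ⟩
  n * n + suc (n + n)                   ≡⟨ lemma n ⟩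
  suc n * suc n                         ∎
  where
  open ≡-Reasoning
  lemma : ∀ n → n * n + suc (n + n) ≡ suc n * suc n
  lemma = solve-∀

∑<-evens-odds : ∀ n f → ∑< (2 * n) f ≡ ∑[ t < n ] f (2 * t) + ∑[ t < n ] f (suc (2 * t))
∑<-evens-odds zero    f = refl
∑<-evens-odds (suc n) f = begin
  ∑< (2 * suc n) f                                             ≡⟨ cong (λ m → ∑< m f) (*-suc 2 n) ⟩
  f 0 + (f 1 + ∑< (2 * n) (f ∘ suc ∘ suc))                     ≡⟨ cong (λ s → f 0 + (f 1 + s)) (∑<-evens-odds n (f ∘ suc ∘ suc)) ⟩
  f 0 + (f 1 + (∑[ t < n ] f (2 + 2 * t) + ∑[ t < n ] f (3 + 2 * t)))
    ≡⟨ cong₂ (λ x y → f 0 + (f 1 + (x + y))) (∑<-cong n (λ t _ → cong f (sym (*-suc 2 t)))) (∑<-cong n (λ t _ → cong (f ∘ suc) (sym (*-suc 2 t)))) ⟩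
  f 0 + (f 1 + (∑[ t < n ] f (2 * suc t) + ∑[ t < n ] f (suc (2 * suc t))))
    ≡⟨ lemma (f 0) (f 1) _ _ ⟩
  (f 0 + ∑[ t < n ] f (2 * suc t)) + (f 1 + ∑[ t < n ] f (suc (2 * suc t))) ∎
  where
  open ≡-Reasoning
  lemma : ∀ a b c d → a + (b + (c + d)) ≡ (a + c) + (b + d)
  lemma = solve-∀

∑<-evens-odds-suc : ∀ n f → ∑< (suc (2 * n)) f ≡ ∑[ t < suc n ] f (2 * t) + ∑[ t < n ] f (suc (2 * t))
∑<-evens-odds-suc n f = begin
  ∑< (suc (2 * n)) f                                  ≡⟨ ∑<-suc (2 * n) f ⟩
  ∑< (2 * n) f + f (2 * n)                            ≡⟨ cong (_+ f (2 * n)) (∑<-evens-odds n f) ⟩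
  ∑[ t < n ] f (2 * t) + ∑[ t < n ] f (suc (2 * t)) + f (2 * n)
    ≡⟨ lemma (∑[ t < n ] f (2 * t)) _ (f (2 * n)) ⟩
  (∑[ t < n ] f (2 * t) + f (2 * n)) + ∑[ t < n ] f (suc (2 * t))
    ≡⟨ cong (_+ ∑[ t < n ] f (suc (2 * t))) (∑<-suc n (λ t → f (2 * t))) ⟨
  ∑[ t < suc n ] f (2 * t) + ∑[ t < n ] f (suc (2 * t)) ∎
  where
  open ≡-Reasoning
  lemma : ∀ a b c → a + b + c ≡ (a + c) + b
  lemma = solve-∀

summand : ℕ → List ℕ → ℕ → ℕ → ℕ
summand a as m x = if a * x ≤ᵇ m then repsℕ as (m ∸ a * x) else 0

reps-cons-∑ : ∀ a as m → repsℕ (a ∷ as) m ≡ ∑< (suc m) (summand a as m)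
reps-cons-∑ a as m = sum-map-applyUpTo (summand a as m) id (suc m)

summand-≤ : ∀ a as {m} x → a * x ≤ m → summand a as m x ≡ repsℕ as (m ∸ a * x)
summand-≤ a as {m} x le with a * x ≤ᵇ m | ≤ᵇ-reflects-≤ (a * x) m
... | true  | _       = refl
... | false | ofⁿ ¬le = ⊥-elim (¬le le)

summand-> : ∀ a as {m} x → m < a * x → summand a as m x ≡ 0
summand-> a as {m} x lt with a * x ≤ᵇ m | ≤ᵇ-reflects-≤ (a * x) m
... | true  | ofʸ le = ⊥-elim (<⇒≱ lt le)
... | false | _      = refl

summand-0 : ∀ a as m → summand a as m 0 ≡ repsℕ as m
summand-0 a as m = trans (summand-≤ a as 0 (≤-trans (≤-reflexive (*-zeroʳ a)) z≤n)) (cong (λ y → repsℕ as (m ∸ y)) (*-zeroʳ a))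

summand-shift : ∀ a .{{_ : NonZero a}} as m x → summand a as (a + m) (suc x) ≡ summand a as m x
summand-shift a as m x with a * x ≤? m
... | yes le = begin
  summand a as (a + m) (suc x)    ≡⟨ summand-≤ a as (suc x) (subst (_≤ a + m) (sym (*-suc a x)) (+-monoʳ-≤ a le)) ⟩
  repsℕ as (a + m ∸ a * suc x)    ≡⟨ cong (λ y → repsℕ as (a + m ∸ y)) (*-suc a x) ⟩
  repsℕ as (a + m ∸ (a + a * x))  ≡⟨ cong (repsℕ as) ([m+n]∸[m+o]≡n∸o a m (a * x)) ⟩
  repsℕ as (m ∸ a * x)            ≡⟨ summand-≤ a as x le ⟨
  summand a as m x                ∎
  where open ≡-Reasoning
... | no ¬le = trans (summand-> a as (suc x) (subst (a + m <_) (sym (*-suc a x)) (+-monoʳ-< a (≰⇒> ¬le))))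
                     (sym (summand-> a as x (≰⇒> ¬le)))

reps-cons-∑-beyond : ∀ a .{{_ : NonZero a}} as {m} n → m < n → repsℕ (a ∷ as) m ≡ ∑< n (summand a as m)
reps-cons-∑-beyond a as {m} n m<n = begin
  repsℕ (a ∷ as) m
    ≡⟨ reps-cons-∑ a as m ⟩
  ∑< (suc m) (summand a as m)
    ≡⟨ +-identityʳ _ ⟨
  ∑< (suc m) (summand a as m) + 0
    ≡⟨ cong (∑< (suc m) (summand a as m) +_) (∑<-zero (n ∸ suc m) (λ x _ → summand-> a as _ (beyond x))) ⟨
  ∑< (suc m) (summand a as m) + ∑[ x < n ∸ suc m ] summand a as m (suc m + x)
    ≡⟨ ∑<-+ (suc m) (n ∸ suc m) (summand a as m) ⟨
  ∑< (suc m + (n ∸ suc m)) (summand a as m)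
    ≡⟨ cong (λ y → ∑< y (summand a as m)) (m+[n∸m]≡n m<n) ⟩
  ∑< n (summand a as m)
    ∎
  where
  open ≡-Reasoning
  beyond : ∀ x → m < a * (suc m + x)
  beyond x = ≤-trans (m≤m+n (suc m) x) (m≤n*m (suc m + x) a)

reps-cons-< : ∀ a as {m} → m < a → repsℕ (a ∷ as) m ≡ repsℕ as m
reps-cons-< a as {m} m<a = begin
  repsℕ (a ∷ as) m
    ≡⟨ reps-cons-∑ a as m ⟩
  summand a as m 0 + ∑[ x < m ] summand a as m (suc x)
    ≡⟨ cong₂ _+_ (summand-0 a as m) (∑<-zero m (λ x _ → summand-> a as (suc x) (≤-trans m<a (m≤m*n a (suc x))))) ⟩
  repsℕ as m + 0
    ≡⟨ +-identityʳ _ ⟩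
  repsℕ as m
    ∎
  where open ≡-Reasoning

reps-cons-+ : ∀ a .{{_ : NonZero a}} as m → repsℕ (a ∷ as) (a + m) ≡ repsℕ as (a + m) + repsℕ (a ∷ as) m
reps-cons-+ a as m = begin
  repsℕ (a ∷ as) (a + m)
    ≡⟨ reps-cons-∑ a as (a + m) ⟩
  summand a as (a + m) 0 + ∑[ x < a + m ] summand a as (a + m) (suc x)
    ≡⟨ cong₂ _+_ (summand-0 a as (a + m)) (∑<-cong (a + m) (λ x _ → summand-shift a as m x)) ⟩
  repsℕ as (a + m) + ∑< (a + m) (summand a as m)
    ≡⟨ cong (repsℕ as (a + m) +_) (reps-cons-∑-beyond a as (a + m) (m<n+m m (>-nonZero⁻¹ a))) ⟨
  repsℕ as (a + m) + repsℕ (a ∷ as) m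
    ∎
  where open ≡-Reasoning

reps-cons-≤-+ : ∀ a .{{_ : NonZero a}} as m → repsℕ (a ∷ as) m ≤ repsℕ (a ∷ as) (m + a)
reps-cons-≤-+ a as m = subst (repsℕ (a ∷ as) m ≤_) (trans (sym (reps-cons-+ a as m)) (cong (repsℕ (a ∷ as)) (+-comm a m)))
                             (m≤n+m _ (repsℕ as (a + m)))

reps-cons-≡0 : ∀ a as {m} → (∀ x → a * x ≤ m → repsℕ as (m ∸ a * x) ≡ 0) → repsℕ (a ∷ as) m ≡ 0
reps-cons-≡0 a as {m} none = trans (reps-cons-∑ a as m) (∑<-zero (suc m) vanish)
  where
  vanish : ∀ x → x < suc m → summand a as m x ≡ 0
  vanish x _ with a * x ≤? m
  ... | yes le = trans (summand-≤ a as x le) (none x le)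
  ... | no ¬le = summand-> a as x (≰⇒> ¬le)

reps-cons-mono : ∀ a as d → (∀ m → repsℕ as m ≤ repsℕ as (m + d)) →
                 ∀ m → repsℕ (a ∷ as) m ≤ repsℕ (a ∷ as) (m + d)
reps-cons-mono a as d mono m = begin
  repsℕ (a ∷ as) m                       ≡⟨ reps-cons-∑ a as m ⟩
  ∑< (suc m) (summand a as m)             ≤⟨ ∑<-mono-≤ (suc m) (λ x _ → summand-mono x) ⟩
  ∑< (suc m) (summand a as (m + d))       ≤⟨ m≤m+n _ _ ⟩
  ∑< (suc m) (summand a as (m + d)) + _   ≡⟨ ∑<-+ (suc m) d (summand a as (m + d)) ⟨
  ∑< (suc m + d) (summand a as (m + d))   ≡⟨ reps-cons-∑ a as (m + d) ⟨
  repsℕ (a ∷ as) (m + d)                  ∎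
  where
  open ≤-Reasoning
  summand-mono : ∀ x → summand a as m x ≤ summand a as (m + d) x
  summand-mono x with a * x ≤? m
  ... | no ¬le = subst (_≤ summand a as (m + d) x) (sym (summand-> a as x (≰⇒> ¬le))) z≤n
  ... | yes le = begin
    summand a as m x          ≡⟨ summand-≤ a as x le ⟩
    repsℕ as (m ∸ a * x)      ≤⟨ mono (m ∸ a * x) ⟩
    repsℕ as (m ∸ a * x + d)  ≡⟨ cong (repsℕ as) (+-∸-comm d le) ⟨
    repsℕ as (m + d ∸ a * x)  ≡⟨ summand-≤ a as x (≤-trans le (m≤m+n m d)) ⟨
    summand a as (m + d) x    ∎

repsℕ-[]-suc : ∀ r → r ≢ 0 → repsℕ [] r ≡ 0
repsℕ-[]-suc zero    r≢0 = ⊥-elim (r≢0 refl)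
repsℕ-[]-suc (suc r) _   = refl

reps-single-+ : ∀ c .{{_ : NonZero c}} m → repsℕ (c ∷ []) (c + m) ≡ repsℕ (c ∷ []) m
reps-single-+ c@(suc _) m = reps-cons-+ c [] m

reps-single-*+ : ∀ c .{{_ : NonZero c}} j r → repsℕ (c ∷ []) (j * c + r) ≡ repsℕ (c ∷ []) r
reps-single-*+ c zero    r = refl
reps-single-*+ c (suc j) r = begin
  repsℕ (c ∷ []) (c + j * c + r)   ≡⟨ cong (repsℕ (c ∷ [])) (+-assoc c (j * c) r) ⟩
  repsℕ (c ∷ []) (c + (j * c + r)) ≡⟨ reps-single-+ c (j * c + r) ⟩
  repsℕ (c ∷ []) (j * c + r)       ≡⟨ reps-single-*+ c j r ⟩
  repsℕ (c ∷ []) r                 ∎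
  where open ≡-Reasoning

reps-single : ∀ c .{{_ : NonZero c}} m → repsℕ (c ∷ []) m ≡ repsℕ [] (m % c)
reps-single c m = begin
  repsℕ (c ∷ []) m                   ≡⟨ cong (repsℕ (c ∷ [])) (trans (m≡m%n+[m/n]*n m c) (+-comm (m % c) _)) ⟩
  repsℕ (c ∷ []) (m / c * c + m % c) ≡⟨ reps-single-*+ c (m / c) (m % c) ⟩
  repsℕ (c ∷ []) (m % c)             ≡⟨ reps-cons-< c [] (m%n<n m c) ⟩
  repsℕ [] (m % c)                   ∎
  where open ≡-Reasoning

reps-single-∣ : ∀ {c m} .{{_ : NonZero c}} → c ∣ m → repsℕ (c ∷ []) m ≡ 1
reps-single-∣ {c} {m} c∣m = trans (reps-single c m) (cong (repsℕ []) (n∣m⇒m%n≡0 m c c∣m))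

reps-single-∤ : ∀ {c m} .{{_ : NonZero c}} → ¬ c ∣ m → repsℕ (c ∷ []) m ≡ 0
reps-single-∤ {c} {m} c∤m = trans (reps-single c m) (repsℕ-[]-suc (m % c) (c∤m ∘ m%n≡0⇒n∣m m c))

-- ⌈x / c⌉, counted as the number of multiples of c below x.
multiplesBelow : ℕ → ℕ → ℕ
multiplesBelow c x = ∑[ v < x ] repsℕ (c ∷ []) v

module _ (c : ℕ) .{{_ : NonZero c}} where

  multiplesBelow-small : ∀ {r} → 0 < r → r ≤ c → multiplesBelow c r ≡ 1
  multiplesBelow-small {suc r} _ r<c =
    cong₂ _+_ (reps-cons-< c [] (>-nonZero⁻¹ c)) (∑<-zero r (λ v v<r → reps-cons-< c [] (<-≤-trans (s<s v<r) r<c)))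

  multiplesBelow-+ : ∀ x → multiplesBelow c (c + x) ≡ suc (multiplesBelow c x)
  multiplesBelow-+ x = begin
    multiplesBelow c (c + x)                                     ≡⟨ ∑<-+ c x _ ⟩
    multiplesBelow c c + ∑[ v < x ] repsℕ (c ∷ []) (c + v)       ≡⟨ cong₂ _+_ (multiplesBelow-small (>-nonZero⁻¹ c) ≤-refl)
                                                                      (∑<-cong x (λ v _ → reps-single-+ c v)) ⟩
    suc (multiplesBelow c x)                                     ∎
    where open ≡-Reasoning

  multiplesBelow-*+ : ∀ j x → multiplesBelow c (j * c + x) ≡ j + multiplesBelow c x
  multiplesBelow-*+ zero    x = refl
  multiplesBelow-*+ (suc j) x = begin
    multiplesBelow c (c + j * c + x)   ≡⟨ cong (multiplesBelow c) (+-assoc c (j * c) x) ⟩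
    multiplesBelow c (c + (j * c + x)) ≡⟨ multiplesBelow-+ (j * c + x) ⟩
    suc (multiplesBelow c (j * c + x)) ≡⟨ cong suc (multiplesBelow-*+ j x) ⟩
    suc j + multiplesBelow c x         ∎
    where open ≡-Reasoning

  multiplesBelow-ceil : ∀ {x} j → x ≤ j * c → j * c < x + c → multiplesBelow c x ≡ j
  multiplesBelow-ceil {x} zero    x≤0 _ = cong (multiplesBelow c) (n≤0⇒n≡0 x≤0)
  multiplesBelow-ceil {x} (suc j) x≤jc+c jc+c<x+c = begin
    multiplesBelow c x                   ≡⟨ cong (multiplesBelow c) (m+[n∸m]≡n (<⇒≤ jc<x)) ⟨
    multiplesBelow c (j * c + r)         ≡⟨ multiplesBelow-*+ j r ⟩
    j + multiplesBelow c r               ≡⟨ cong (j +_) (multiplesBelow-small (m<n⇒0<n∸m jc<x) r≤c) ⟩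
    j + 1                                ≡⟨ +-comm j 1 ⟩
    suc j                                ∎
    where
    open ≡-Reasoning
    r = x ∸ j * c
    jc<x : j * c < x
    jc<x = +-cancelˡ-< c (j * c) x (subst (c + j * c <_) (+-comm x c) jc+c<x+c)
    r≤c : r ≤ c
    r≤c = ≤-trans (∸-monoˡ-≤ (j * c) x≤jc+c) (≤-reflexive (m+n∸n≡m c (j * c)))

  multiplesBelow-* : ∀ x → multiplesBelow c (x * c) ≡ x
  multiplesBelow-* x = multiplesBelow-ceil x ≤-refl (m<m+n (x * c) (>-nonZero⁻¹ c))

  multiplesBelow-*+1 : ∀ x → multiplesBelow c (suc (x * c)) ≡ suc x
  multiplesBelow-*+1 x = multiplesBelow-ceil (suc x) (+-monoˡ-≤ (x * c) (>-nonZero⁻¹ c)) (s≤s (≤-reflexive (+-comm c (x * c))))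

  multiplesBelow-near : ∀ x d t e → x + d ≡ t * c + e → e ≤ c → d < c + e → multiplesBelow c x ≡ t + χ[ d < e ]
  multiplesBelow-near x d t e eq e≤c d<c+e with d <? e
  ... | yes d<e = trans (multiplesBelow-ceil (suc t) x≤tc+c tc+c<x+c) (trans (+-comm 1 t) (cong (t +_) (sym (χ-< d<e))))
    where
    open ≤-Reasoning
    x≤tc+c : x ≤ c + t * c
    x≤tc+c = begin
      x            ≤⟨ m≤m+n x d ⟩
      x + d        ≡⟨ eq ⟩
      t * c + e    ≤⟨ +-monoʳ-≤ (t * c) e≤c ⟩
      t * c + c    ≡⟨ +-comm (t * c) c ⟩
      c + t * c    ∎
    tc+c<x+c : c + t * c < x + c
    tc+c<x+c = subst₂ _<_ (+-comm (t * c) c) refl (+-monoˡ-< c (+-cancelʳ-< e (t * c) x (subst (_< x + e) eq (+-monoʳ-< x d<e))))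
  ... | no d≮e = trans (multiplesBelow-ceil t x≤tc tc<x+c) (sym (trans (cong (t +_) (χ-≥ (≮⇒≥ d≮e))) (+-identityʳ t)))
    where
    x≤tc : x ≤ t * c
    x≤tc = +-cancelʳ-≤ d x (t * c) (subst (_≤ t * c + d) (sym eq) (+-monoʳ-≤ (t * c) (≮⇒≥ d≮e)))
    tc<x+c : t * c < x + c
    tc<x+c = +-cancelʳ-< e (t * c) (x + c) (subst₂ _<_ eq (sym (+-assoc x c e)) (+-monoʳ-< x d<c+e))

m∸n+[n+o]≡m+o : ∀ {m n} o → n ≤ m → m ∸ n + (n + o) ≡ m + o
m∸n+[n+o]≡m+o {m} {n} o n≤m = trans (sym (+-assoc (m ∸ n) n o)) (cong (_+ o) (m∸n+n≡m n≤m))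

module Pair (b c : ℕ) .{{_ : NonZero b}} .{{_ : NonZero c}} (b⊥c : Coprime b c) where

  c∣b*t⇒c∣t : ∀ {t} → c ∣ b * t → c ∣ t
  c∣b*t⇒c∣t = coprime-divisor (Coprimality.sym b⊥c)

  c∤m : ∀ {m j z} → m + b * j ≡ c * z → 0 < j → z < b → ¬ c ∣ m
  c∤m {m} {j} {z} eq 0<j z<b c∣m = <⇒≱ z<b (*-cancelˡ-≤ c (begin
    c * b      ≡⟨ *-comm c b ⟩
    b * c      ≤⟨ *-monoʳ-≤ b (∣⇒≤ {{>-nonZero 0<j}} c∣j) ⟩
    b * j      ≤⟨ m≤n+m (b * j) m ⟩
    m + b * j  ≡⟨ eq ⟩
    c * z      ∎))
    where
    open ≤-Reasoning
    c∣j : c ∣ j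
    c∣j = c∣b*t⇒c∣t (∣m+n∣m⇒∣n (subst (c ∣_) (sym eq) (m∣m*n z)) c∣m)

  reps-single-linear : ∀ t z → repsℕ (c ∷ []) (b * t + c * z) ≡ repsℕ (c ∷ []) t
  reps-single-linear t z with c ∣? t
  ... | yes c∣t = trans (reps-single-∣ (∣m∣n⇒∣m+n (∣-trans c∣t (n∣m*n b)) (m∣m*n z))) (sym (reps-single-∣ c∣t))
  ... | no  c∤t = trans (reps-single-∤ (c∤t ∘ c∣b*t⇒c∣t ∘ c∣b*t)) (sym (reps-single-∤ c∤t))
    where
    c∣b*t : c ∣ b * t + c * z → c ∣ b * t
    c∣b*t c∣sum = ∣m+n∣m⇒∣n (subst (c ∣_) (+-comm (b * t) (c * z)) c∣sum) (m∣m*n z)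

  reps-pair-≡0 : ∀ {m j z} → m + b * j ≡ c * z → 0 < j → z < b → repsℕ (b ∷ c ∷ []) m ≡ 0
  reps-pair-≡0 {m} {j} {z} eq 0<j z<b =
    reps-cons-≡0 b (c ∷ []) (λ x bx≤m → reps-single-∤ (c∤m (shifted x bx≤m) (<-≤-trans 0<j (m≤n+m j x)) z<b))
    where
    shifted : ∀ x → b * x ≤ m → m ∸ b * x + b * (x + j) ≡ c * z
    shifted x bx≤m = trans (cong (m ∸ b * x +_) (*-distribˡ-+ b x j)) (trans (m∸n+[n+o]≡m+o (b * j) bx≤m) eq)

  drop-b : ∀ {m V z} → m + b ≡ b * suc V + c * z → m ≡ b * V + c * z
  drop-b {m} {V} {z} eq = +-cancelʳ-≡ b m _ (trans eq (lemma b V c z))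
    where
    lemma : ∀ b V c z → b * suc V + c * z ≡ b * V + c * z + b
    lemma = solve-∀

  reps-pair : ∀ V {m z} → z < b → m + b ≡ b * V + c * z → repsℕ (b ∷ c ∷ []) m ≡ multiplesBelow c V
  reps-pair zero {m} {z} z<b eq =
    reps-pair-≡0 (trans (cong (m +_) (*-identityʳ b)) (trans eq (cong (_+ c * z) (*-zeroʳ b)))) z<s z<b
  reps-pair (suc V) {m} {z} z<b eq with m <? b
  ... | yes m<b = begin
    repsℕ (b ∷ c ∷ []) m                        ≡⟨ reps-cons-< b (c ∷ []) m<b ⟩
    repsℕ (c ∷ []) m                            ≡⟨ cong (repsℕ (c ∷ [])) m≡bV+cz ⟩
    repsℕ (c ∷ []) (b * V + c * z)              ≡⟨ reps-single-linear V z ⟩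
    repsℕ (c ∷ []) V                            ≡⟨ cong (λ v → multiplesBelow c v + repsℕ (c ∷ []) V) V≡0 ⟨
    multiplesBelow c V + repsℕ (c ∷ []) V       ≡⟨ ∑<-suc V _ ⟨
    multiplesBelow c (suc V)                    ∎
    where
    open ≡-Reasoning
    m≡bV+cz : m ≡ b * V + c * z
    m≡bV+cz = drop-b eq
    V≡0 : V ≡ 0
    V≡0 = n<1⇒n≡0 (*-cancelˡ-< b V 1 (≤-<-trans (m≤m+n (b * V) (c * z)) (subst₂ _<_ m≡bV+cz (sym (*-identityʳ b)) m<b)))
  ... | no m≮b = begin
    repsℕ (b ∷ c ∷ []) m                        ≡⟨ cong (repsℕ (b ∷ c ∷ [])) m≡b+m′ ⟩
    repsℕ (b ∷ c ∷ []) (b + m′)                 ≡⟨ reps-cons-+ b (c ∷ []) m′ ⟩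
    repsℕ (c ∷ []) (b + m′) + repsℕ (b ∷ c ∷ []) m′
      ≡⟨ cong₂ _+_ (trans (cong (repsℕ (c ∷ [])) b+m′≡bV+cz) (reps-single-linear V z)) (reps-pair V z<b m′+b≡bV+cz) ⟩
    repsℕ (c ∷ []) V + multiplesBelow c V       ≡⟨ +-comm (repsℕ (c ∷ []) V) (multiplesBelow c V) ⟩
    multiplesBelow c V + repsℕ (c ∷ []) V       ≡⟨ ∑<-suc V _ ⟨
    multiplesBelow c (suc V)                    ∎
    where
    open ≡-Reasoning
    m′ = m ∸ b
    m≡b+m′ : m ≡ b + m′
    m≡b+m′ = sym (m+[n∸m]≡n (≮⇒≥ m≮b))
    b+m′≡bV+cz : b + m′ ≡ b * V + c * z
    b+m′≡bV+cz = trans (sym m≡b+m′) (drop-b eq)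
    m′+b≡bV+cz : m′ + b ≡ b * V + c * z
    m′+b≡bV+cz = trans (+-comm m′ b) b+m′≡bV+cz

ceilSum : ℕ → ℕ → ℕ → ℕ → ℕ
ceilSum c q e u = ∑[ j < suc u ] multiplesBelow c (j * q + e)

module Triple (b c q : ℕ) .{{_ : NonZero b}} .{{_ : NonZero c}} .{{_ : NonZero q}} (b⊥c : Coprime b c) where
  open Pair b c b⊥c

  instance
    q*b≢0 : NonZero (q * b)
    q*b≢0 = m*n≢0 q b

  reps-triple-≡0 : ∀ {m j z} → m + b * j ≡ c * z → 0 < j → z < b → repsℕ (q * b ∷ b ∷ c ∷ []) m ≡ 0
  reps-triple-≡0 {m} {j} {z} eq 0<j z<b =
    reps-cons-≡0 (q * b) (b ∷ c ∷ []) (λ x qbx≤m → reps-pair-≡0 (shifted x qbx≤m) (<-≤-trans 0<j (m≤n+m j (q * x))) z<b)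
    where
    shifted : ∀ x → q * b * x ≤ m → m ∸ q * b * x + b * (q * x + j) ≡ c * z
    shifted x qbx≤m = trans (cong (m ∸ q * b * x +_) (lemma b q x j)) (trans (m∸n+[n+o]≡m+o (b * j) qbx≤m) eq)
      where
      lemma : ∀ b q x j → b * (q * x + j) ≡ q * b * x + b * j
      lemma = solve-∀

  below-q*b : ∀ {u e m z} → m < q * b → m + b ≡ b * (suc u * q + e) + c * z → u * q + e ≡ 0
  below-q*b {u} {e} {m} {z} m<qb eq = n<1⇒n≡0 (+-cancelˡ-< q _ 1 (*-cancelˡ-< b _ (q + 1) (begin-strict
    b * (q + (u * q + e))        ≡⟨ cong (b *_) (+-assoc q (u * q) e) ⟨
    b * (suc u * q + e)          ≤⟨ m≤m+n _ (c * z) ⟩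
    b * (suc u * q + e) + c * z  ≡⟨ eq ⟨
    m + b                        <⟨ +-monoˡ-< b m<qb ⟩
    q * b + b                    ≡⟨ lemma q b ⟩
    b * (q + 1)                  ∎)))
    where
    open ≤-Reasoning
    lemma : ∀ q b → q * b + b ≡ b * (q + 1)
    lemma = solve-∀

  reps-triple-peel : ∀ {W m z} → z < b → m + b ≡ b * W + c * z → q * b ≤ m →
                     repsℕ (q * b ∷ b ∷ c ∷ []) m ≡ multiplesBelow c W + repsℕ (q * b ∷ b ∷ c ∷ []) (m ∸ q * b)
  reps-triple-peel {W} {m} z<b eq qb≤m = begin
    repsℕ (q * b ∷ b ∷ c ∷ []) m
      ≡⟨ cong (repsℕ (q * b ∷ b ∷ c ∷ [])) (m+[n∸m]≡n qb≤m) ⟨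
    repsℕ (q * b ∷ b ∷ c ∷ []) (q * b + (m ∸ q * b))
      ≡⟨ reps-cons-+ (q * b) (b ∷ c ∷ []) (m ∸ q * b) ⟩
    repsℕ (b ∷ c ∷ []) (q * b + (m ∸ q * b)) + repsℕ (q * b ∷ b ∷ c ∷ []) (m ∸ q * b)
      ≡⟨ cong (_+ repsℕ (q * b ∷ b ∷ c ∷ []) (m ∸ q * b))
              (trans (cong (repsℕ (b ∷ c ∷ [])) (m+[n∸m]≡n qb≤m)) (reps-pair W z<b eq)) ⟩
    multiplesBelow c W + repsℕ (q * b ∷ b ∷ c ∷ []) (m ∸ q * b)
      ∎
    where open ≡-Reasoning

  reps-triple : ∀ u {e m z} → e ≤ q → z < b → m + b ≡ b * (u * q + e) + c * z →
                repsℕ (q * b ∷ b ∷ c ∷ []) m ≡ ceilSum c q e u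
  reps-triple u {e} {m} {z} e≤q z<b eq with m <? q * b
  reps-triple zero {e} {m} {z} e≤q z<b eq | yes m<qb =
    trans (reps-cons-< (q * b) (b ∷ c ∷ []) m<qb) (trans (reps-pair e z<b eq) (sym (+-identityʳ _)))
  reps-triple (suc u) {e} {m} {z} e≤q z<b eq | yes m<qb = begin
    repsℕ (q * b ∷ b ∷ c ∷ []) m                        ≡⟨ reps-cons-< (q * b) (b ∷ c ∷ []) m<qb ⟩
    repsℕ (b ∷ c ∷ []) m                                ≡⟨ reps-pair (suc u * q + e) z<b eq ⟩
    multiplesBelow c (suc u * q + e)                    ≡⟨ cong (_+ multiplesBelow c (suc u * q + e)) lower≡0 ⟨
    ceilSum c q e u + multiplesBelow c (suc u * q + e)  ≡⟨ ∑<-suc (suc u) (λ j → multiplesBelow c (j * q + e)) ⟨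
    ceilSum c q e (suc u)                               ∎
    where
    open ≡-Reasoning
    uq+e≡0 : u * q + e ≡ 0
    uq+e≡0 = below-q*b {u} m<qb eq
    lower≡0 : ceilSum c q e u ≡ 0
    lower≡0 rewrite m*n≡0⇒m≡0 u q (m+n≡0⇒m≡0 (u * q) uq+e≡0) | m+n≡0⇒n≡0 (u * q) uq+e≡0 = refl
  reps-triple zero {e} {m} {z} e≤q z<b eq | no m≮qb =
    trans (reps-triple-peel z<b eq qb≤m) (cong (multiplesBelow c e +_) (reps-triple-≡0 rest z<s z<b))
    where
    open ≡-Reasoning
    qb≤m = ≮⇒≥ m≮qb
    d = q ∸ e
    lemma : ∀ m′ b d e → m′ + b * suc d + b * e ≡ m′ + (e + d) * b + b
    lemma = solve-∀
    rest : m ∸ q * b + b * suc d ≡ c * z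
    rest = +-cancelʳ-≡ (b * e) _ _ (begin
      m ∸ q * b + b * suc d + b * e  ≡⟨ lemma (m ∸ q * b) b d e ⟩
      m ∸ q * b + (e + d) * b + b    ≡⟨ cong (λ q′ → m ∸ q * b + q′ * b + b) (m+[n∸m]≡n e≤q) ⟩
      m ∸ q * b + q * b + b          ≡⟨ cong (_+ b) (m∸n+n≡m qb≤m) ⟩
      m + b                          ≡⟨ eq ⟩
      b * e + c * z                  ≡⟨ +-comm (b * e) (c * z) ⟩
      c * z + b * e                  ∎)
  reps-triple (suc u) {e} {m} {z} e≤q z<b eq | no m≮qb = begin
    repsℕ (q * b ∷ b ∷ c ∷ []) m
      ≡⟨ reps-triple-peel z<b eq qb≤m ⟩
    multiplesBelow c (suc u * q + e) + repsℕ (q * b ∷ b ∷ c ∷ []) (m ∸ q * b)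
      ≡⟨ cong (multiplesBelow c (suc u * q + e) +_) (reps-triple u e≤q z<b rest) ⟩
    multiplesBelow c (suc u * q + e) + ceilSum c q e u
      ≡⟨ +-comm _ (ceilSum c q e u) ⟩
    ceilSum c q e u + multiplesBelow c (suc u * q + e)
      ≡⟨ ∑<-suc (suc u) (λ j → multiplesBelow c (j * q + e)) ⟨
    ceilSum c q e (suc u)
      ∎
    where
    open ≡-Reasoning
    qb≤m = ≮⇒≥ m≮qb
    lemma : ∀ m′ b q → m′ + b + q * b ≡ m′ + q * b + b
    lemma = solve-∀
    lemma₂ : ∀ b q u e x → b * (suc u * q + e) + x ≡ b * (u * q + e) + x + q * b
    lemma₂ = solve-∀
    rest : m ∸ q * b + b ≡ b * (u * q + e) + c * z
    rest = +-cancelʳ-≡ (q * b) _ _ (begin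
      m ∸ q * b + b + q * b          ≡⟨ lemma (m ∸ q * b) b q ⟩
      m ∸ q * b + q * b + b          ≡⟨ cong (_+ b) (m∸n+n≡m qb≤m) ⟩
      m + b                          ≡⟨ eq ⟩
      b * (suc u * q + e) + c * z    ≡⟨ lemma₂ b q u e (c * z) ⟩
      b * (u * q + e) + c * z + q * b ∎)

-- Bézout: c is invertible modulo b.
congruent-multiple : ∀ {b c} .{{_ : NonZero b}} → Coprime b c → ∀ X → ∃ λ Z → ∃₂ λ k l → X + b * k ≡ c * Z + b * l
congruent-multiple {b} {c} b⊥c X with coprime-Bézout b⊥c
... | Bézout.-+ x y 1+xb≡yc = y * X , x * X , 0 , (begin
  X + b * (x * X)  ≡⟨ lemma X b x ⟩
  (1 + x * b) * X  ≡⟨ cong (_* X) 1+xb≡yc ⟩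
  y * c * X        ≡⟨ lemma₂ y c X b ⟩
  c * (y * X) + b * 0 ∎)
  where
  open ≡-Reasoning
  lemma : ∀ X b x → X + b * (x * X) ≡ (1 + x * b) * X
  lemma = solve-∀
  lemma₂ : ∀ y c X b → y * c * X ≡ c * (y * X) + b * 0
  lemma₂ = solve-∀
congruent-multiple {b@(suc b′)} {c} b⊥c X | Bézout.+- x y 1+yc≡xb = y * b′ * X , x * b′ * X , X , (begin
  X + b * (x * b′ * X)      ≡⟨ lemma X b′ x ⟩
  X + x * b * b′ * X        ≡⟨ cong (λ w → X + w * b′ * X) 1+yc≡xb ⟨
  X + (1 + y * c) * b′ * X  ≡⟨ lemma₂ X b′ y c ⟩
  c * (y * b′ * X) + b * X  ∎)
  where
  open ≡-Reasoning
  lemma : ∀ X b′ x → X + suc b′ * (x * b′ * X) ≡ X + x * suc b′ * b′ * X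
  lemma = solve-∀
  lemma₂ : ∀ X b′ y c → X + (1 + y * c) * b′ * X ≡ c * (y * b′ * X) + suc b′ * X
  lemma₂ = solve-∀

-- c * b ≤ X + c says X ≥ c (b - 1) without truncated subtraction.
decompose : ∀ {b c} .{{_ : NonZero b}} → Coprime b c → ∀ X → c * b ≤ X + c → ∃₂ λ V z → z < b × X ≡ b * V + c * z
decompose {b} {c} b⊥c X cb≤X+c with congruent-multiple b⊥c X
... | Z , k , l , X+bk≡cZ+bl = V , z , m%n<n Z b , X≡bV+cz
  where
  open ≡-Reasoning
  z = Z % b
  cz≤X : c * z ≤ X
  cz≤X = +-cancelʳ-≤ c (c * z) X (subst (_≤ X + c) (trans (*-suc c z) (+-comm c (c * z))) (≤-trans (*-monoʳ-≤ c (m%n<n Z b)) cb≤X+c))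
  lemma : ∀ c z w b l → c * (z + w * b) + b * l ≡ b * (c * w + l) + c * z
  lemma = solve-∀
  bk+[X∸cz]≡ : b * k + (X ∸ c * z) ≡ b * (c * (Z / b) + l)
  bk+[X∸cz]≡ = +-cancelʳ-≡ (c * z) _ _ (begin
    b * k + (X ∸ c * z) + c * z    ≡⟨ +-assoc (b * k) _ _ ⟩
    b * k + (X ∸ c * z + c * z)    ≡⟨ cong (b * k +_) (m∸n+n≡m cz≤X) ⟩
    b * k + X                      ≡⟨ +-comm (b * k) X ⟩
    X + b * k                      ≡⟨ X+bk≡cZ+bl ⟩
    c * Z + b * l                  ≡⟨ cong (λ w → c * w + b * l) (m≡m%n+[m/n]*n Z b) ⟩
    c * (z + Z / b * b) + b * l    ≡⟨ lemma c z (Z / b) b l ⟩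
    b * (c * (Z / b) + l) + c * z  ∎)
  b∣X∸cz : b ∣ X ∸ c * z
  b∣X∸cz = ∣m+n∣m⇒∣n (divides (c * (Z / b) + l) (trans bk+[X∸cz]≡ (*-comm b _))) (m∣m*n k)
  V = _∣_.quotient b∣X∸cz
  X≡bV+cz : X ≡ b * V + c * z
  X≡bV+cz = begin
    X                ≡⟨ m∸n+n≡m cz≤X ⟨
    X ∸ c * z + c * z ≡⟨ cong (_+ c * z) (trans (_∣_.equality b∣X∸cz) (*-comm V b)) ⟩
    b * V + c * z    ∎

iterate-mono : ∀ (f : ℕ → ℕ) b → (∀ m → f m ≤ f (m + b)) → ∀ d m → f m ≤ f (m + b * d)
iterate-mono f b mono zero    m = ≤-reflexive (cong f (sym (trans (cong (m +_) (*-zeroʳ b)) (+-identityʳ m))))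
iterate-mono f b mono (suc d) m = ≤-trans (mono m) (≤-trans (iterate-mono f b mono d (m + b)) (≤-reflexive (cong f m+b+bd≡)))
  where
  m+b+bd≡ : m + b + b * d ≡ m + b * suc d
  m+b+bd≡ = trans (+-assoc m b (b * d)) (cong (m +_) (sym (*-suc b d)))

-- Walk down from m in steps of b to the point with V = W + 1.
reps-above : ∀ L {b c s W} .{{_ : NonZero b}} → Coprime b c → (∀ m → repsℕ L m ≤ repsℕ L (m + b)) →
             (∀ m z → z < b → m + b ≡ b * suc W + c * z → s < repsℕ L m) →
             ∀ m → b * W + c * b < m + (b + c) → s < repsℕ L m
reps-above L {b} {c} {s} {W} b⊥c mono next m F<m = from (decompose b⊥c (m + b) cb≤m+b+c)
  where
  cb≤m+b+c : c * b ≤ m + b + c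
  cb≤m+b+c = ≤-trans (m≤n+m (c * b) (b * W)) (≤-trans (<⇒≤ F<m) (≤-reflexive (sym (+-assoc m b c))))
  from : (∃₂ λ V z → z < b × m + b ≡ b * V + c * z) → s < repsℕ L m
  from (V , z , z<b , m+b≡bV+cz) = <-≤-trans (next P z z<b P+b≡) (≤-trans (iterate-mono (repsℕ L) b mono d P) (≤-reflexive (cong (repsℕ L) P+bd≡m)))
    where
    P = b * W + c * z
    P+b≡ : P + b ≡ b * suc W + c * z
    P+b≡ = lemma b W c z
      where
      lemma : ∀ b W c z → b * W + c * z + b ≡ b * suc W + c * z
      lemma = solve-∀
    W<V : W < V
    W<V = *-cancelˡ-< b W V (+-cancelʳ-< (c * suc z) (b * W) (b * V) (begin-strict
      b * W + c * suc z       ≤⟨ +-monoʳ-≤ (b * W) (*-monoʳ-≤ c z<b) ⟩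
      b * W + c * b           <⟨ F<m ⟩
      m + (b + c)             ≡⟨ +-assoc m b c ⟨
      m + b + c               ≡⟨ cong (_+ c) m+b≡bV+cz ⟩
      b * V + c * z + c       ≡⟨ lemma b V c z ⟩
      b * V + c * suc z       ∎))
      where
      open ≤-Reasoning
      lemma : ∀ b V c z → b * V + c * z + c ≡ b * V + c * suc z
      lemma = solve-∀
    d = V ∸ suc W
    P+bd≡m : P + b * d ≡ m
    P+bd≡m = +-cancelʳ-≡ b _ _ (trans (lemma b W c z d) (trans (cong (λ v → b * v + c * z) (m+[n∸m]≡n W<V)) (sym m+b≡bV+cz)))
      where
      lemma : ∀ b W c z d → b * W + c * z + b * d + b ≡ b * (suc W + d) + c * z
      lemma = solve-∀

3[1+t]<x+3⇒3t<x : ∀ {t x} → 3 * suc t < x + 3 → 3 * t < x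
3[1+t]<x+3⇒3t<x {t} {x} lt = +-cancelʳ-< 3 (3 * t) x (subst (_< x + 3) (trans (*-suc 3 t) (+-comm 3 (3 * t))) lt)

module EvenSums (q : ℕ) where

  c : ℕ
  c = suc (2 * q) + 2

  even-index : ∀ {t e} → e ≤ c → 3 * t < c + e → multiplesBelow c (2 * t * q + e) ≡ t + χ[ 3 * t < e ]
  even-index {t} {e} = multiplesBelow-near c (2 * t * q + e) (3 * t) t e (lemma t q e)
    where
    lemma : ∀ t q e → 2 * t * q + e + 3 * t ≡ t * (suc (2 * q) + 2) + e
    lemma = solve-∀

  odd-index : ∀ {t e} → e ≤ q → 3 * t < q + e → multiplesBelow c (suc (2 * t) * q + e) ≡ suc t
  odd-index {t} {e} e≤q 3t<q+e = begin
    multiplesBelow c (suc (2 * t) * q + e)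
      ≡⟨ multiplesBelow-near c (suc (2 * t) * q + e) (3 * t) t (q + e) (lemma t q e) q+e≤c (<-≤-trans 3t<q+e (m≤n+m _ c)) ⟩
    t + χ[ 3 * t < q + e ]
      ≡⟨ cong (t +_) (χ-< 3t<q+e) ⟩
    t + 1
      ≡⟨ +-comm t 1 ⟩
    suc t
      ∎
    where
    open ≡-Reasoning
    lemma : ∀ t q e → suc (2 * t) * q + e + 3 * t ≡ t * (suc (2 * q) + 2) + (q + e)
    lemma = solve-∀
    q+e≤c : q + e ≤ c
    q+e≤c = ≤-trans (+-monoʳ-≤ q e≤q) (≤-trans (≤-reflexive (solve-q q)) (≤-trans (m≤m+n (2 * q) 2) (n≤1+n _)))
      where
      solve-q : ∀ q → q + q ≡ 2 * q
      solve-q = solve-∀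

  q≤c : q ≤ c
  q≤c = ≤-trans (m≤m+n q (q + 0)) (≤-trans (m≤m+n (2 * q) 2) (n≤1+n _))

  q+3≤c : q + 3 ≤ c
  q+3≤c = ≤-trans (+-monoˡ-≤ 3 (m≤m+n q (q + 0))) (≤-reflexive (+-suc (2 * q) 2))

  ceilSum-even : ∀ k e i → e ≤ q → 3 * k < q + 3 → (∀ t → χ[ 3 * t < e ] ≡ χ[ t < i ]) → i ≤ suc k →
                 ceilSum c q e (2 * k) ≡ k * (k + 1) + i
  ceilSum-even k e i e≤q 3k<q+3 χ≡ i≤1+k = begin
    ceilSum c q e (2 * k)                                  ≡⟨ ∑<-evens-odds-suc k f ⟩
    ∑[ t < suc k ] f (2 * t) + ∑[ t < k ] f (suc (2 * t))  ≡⟨ cong₂ _+_ (∑<-+χ (suc k) i i≤1+k evens) (∑<-cong k odds) ⟩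
    ∑[ t < suc k ] t + i + ∑[ t < suc k ] t                ≡⟨ lemma (∑[ t < suc k ] t) i ⟩
    ∑[ t < suc k ] t + ∑[ t < suc k ] t + i                ≡⟨ cong (_+ i) (∑<-+-distrib (suc k) id id) ⟨
    ∑[ t < suc k ] (t + t) + i                             ≡⟨ cong (_+ i) (∑<-double k) ⟩
    k * (k + 1) + i                                        ∎
    where
    open ≡-Reasoning
    f : ℕ → ℕ
    f j = multiplesBelow c (j * q + e)
    lemma : ∀ a i → a + i + a ≡ a + a + i
    lemma = solve-∀
    evens : ∀ t → t < suc k → f (2 * t) ≡ t + χ[ t < i ]
    evens t t≤k = trans (even-index {t} (≤-trans e≤q q≤c) 3t<c+e) (cong (t +_) (χ≡ t))
      where
      3t<c+e : 3 * t < c + e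
      3t<c+e = ≤-<-trans (*-monoʳ-≤ 3 (≤-pred t≤k)) (<-≤-trans 3k<q+3 (≤-trans q+3≤c (m≤m+n c e)))
    odds : ∀ t → t < k → f (suc (2 * t)) ≡ suc t
    odds t t<k = odd-index {t} e≤q (<-≤-trans 3t<q (m≤m+n q e))
      where
      3t<q : 3 * t < q
      3t<q = 3[1+t]<x+3⇒3t<x (≤-<-trans (*-monoʳ-≤ 3 t<k) 3k<q+3)

  ceilSum-even-suc : ∀ k e i → e ≤ q → 3 * k < q → (∀ t → χ[ 3 * t < e ] ≡ χ[ t < i ]) → i ≤ suc k →
                     ceilSum c q e (suc (2 * k)) ≡ suc k * suc k + i
  ceilSum-even-suc k e i e≤q 3k<q χ≡ i≤1+k = begin
    ceilSum c q e (suc (2 * k))                                ≡⟨ cong (λ n → ∑< n f) (*-suc 2 k) ⟨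
    ∑< (2 * suc k) f                                           ≡⟨ ∑<-evens-odds (suc k) f ⟩
    ∑[ t < suc k ] f (2 * t) + ∑[ t < suc k ] f (suc (2 * t))  ≡⟨ cong₂ _+_ (∑<-+χ (suc k) i i≤1+k evens) (∑<-cong (suc k) odds) ⟩
    ∑[ t < suc k ] t + i + ∑[ t < suc k ] suc t                ≡⟨ lemma (∑[ t < suc k ] t) i _ ⟩
    ∑[ t < suc k ] t + ∑[ t < suc k ] suc t + i                ≡⟨ cong (_+ i) (∑<-+-distrib (suc k) id suc) ⟨
    ∑[ t < suc k ] (t + suc t) + i                             ≡⟨ cong (_+ i) (∑<-cong (suc k) (λ t _ → +-suc t t)) ⟩
    ∑[ t < suc k ] suc (t + t) + i                             ≡⟨ cong (_+ i) (∑<-odd (suc k)) ⟩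
    suc k * suc k + i                                          ∎
    where
    open ≡-Reasoning
    f : ℕ → ℕ
    f j = multiplesBelow c (j * q + e)
    lemma : ∀ a i b → a + i + b ≡ a + b + i
    lemma = solve-∀
    3t<q : ∀ t → t < suc k → 3 * t < q
    3t<q t t≤k = ≤-<-trans (*-monoʳ-≤ 3 (≤-pred t≤k)) 3k<q
    evens : ∀ t → t < suc k → f (2 * t) ≡ t + χ[ t < i ]
    evens t t≤k = trans (even-index {t} (≤-trans e≤q q≤c) (<-≤-trans (3t<q t t≤k) (≤-trans q≤c (m≤m+n c e)))) (cong (t +_) (χ≡ t))
    odds : ∀ t → t < suc k → f (suc (2 * t)) ≡ suc t
    odds t t≤k = odd-index {t} e≤q (<-≤-trans (3t<q t t≤k) (m≤m+n q e))

module OddSums (M : ℕ) where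

  q c : ℕ
  q = suc (2 * M)
  c = suc M + 1

  index : ∀ {j e} → e ≤ c → 3 * j < c + e → multiplesBelow c (j * q + e) ≡ j + j + χ[ 3 * j < e ]
  index {j} {e} = multiplesBelow-near c (j * q + e) (3 * j) (j + j) e (lemma j M e)
    where
    lemma : ∀ j M e → j * suc (2 * M) + e + 3 * j ≡ (j + j) * (suc M + 1) + e
    lemma = solve-∀

  index-+c : ∀ {j e} → e ≤ c → 3 * j < c + e → multiplesBelow c (j * q + (e + c)) ≡ suc (j + j) + χ[ 3 * j < e ]
  index-+c {j} {e} = multiplesBelow-near c (j * q + (e + c)) (3 * j) (suc (j + j)) e (lemma j M e)
    where
    lemma : ∀ j M e → j * suc (2 * M) + (e + (suc M + 1)) + 3 * j ≡ suc (j + j) * (suc M + 1) + e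
    lemma = solve-∀

  ceilSum-odd : ∀ k e i → e ≤ c → 3 * k < c → (∀ j → χ[ 3 * j < e ] ≡ χ[ j < i ]) → i ≤ suc k →
                ceilSum c q e k ≡ k * (k + 1) + i
  ceilSum-odd k e i e≤c 3k<c χ≡ i≤1+k = begin
    ceilSum c q e k             ≡⟨ ∑<-+χ (suc k) i i≤1+k terms ⟩
    ∑[ j < suc k ] (j + j) + i  ≡⟨ cong (_+ i) (∑<-double k) ⟩
    k * (k + 1) + i             ∎
    where
    open ≡-Reasoning
    terms : ∀ j → j < suc k → multiplesBelow c (j * q + e) ≡ j + j + χ[ j < i ]
    terms j j≤k = trans (index {j} e≤c (≤-<-trans (*-monoʳ-≤ 3 (≤-pred j≤k)) (<-≤-trans 3k<c (m≤m+n c e)))) (cong (j + j +_) (χ≡ j))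

  ceilSum-odd-+c : ∀ k e i → e ≤ c → 3 * k < c → (∀ j → χ[ 3 * j < e ] ≡ χ[ j < i ]) → i ≤ suc k →
                   ceilSum c q (e + c) k ≡ suc k * suc k + i
  ceilSum-odd-+c k e i e≤c 3k<c χ≡ i≤1+k = begin
    ceilSum c q (e + c) k           ≡⟨ ∑<-+χ (suc k) i i≤1+k terms ⟩
    ∑[ j < suc k ] suc (j + j) + i  ≡⟨ cong (_+ i) (∑<-odd (suc k)) ⟩
    suc k * suc k + i               ∎
    where
    open ≡-Reasoning
    terms : ∀ j → j < suc k → multiplesBelow c (j * q + (e + c)) ≡ suc (j + j) + χ[ j < i ]
    terms j j≤k = trans (index-+c {j} e≤c (≤-<-trans (*-monoʳ-≤ 3 (≤-pred j≤k)) (<-≤-trans 3k<c (m≤m+n c e)))) (cong (suc (j + j) +_) (χ≡ j))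

if-≤ᵇ : ∀ {A : Set} {i k} {x y : A} → i ≤ k → (if i ≤ᵇ k then x else y) ≡ x
if-≤ᵇ {i = i} {k} i≤k with i ≤ᵇ k | ≤ᵇ-reflects-≤ i k
... | true  | _        = refl
... | false | ofⁿ i≰k = ⊥-elim (i≰k i≤k)

if-≰ᵇ : ∀ {A : Set} {i k} {x y : A} → k < i → (if i ≤ᵇ k then x else y) ≡ y
if-≰ᵇ {i = i} {k} k<i with i ≤ᵇ k | ≤ᵇ-reflects-≤ i k
... | true  | ofʸ i≤k = ⊥-elim (<⇒≱ k<i i≤k)
... | false | _       = refl

if-%2-even : ∀ {A : Set} n {x y : A} → n % 2 ≡ 0 → (if n % 2 ≡ᵇ 0 then x else y) ≡ x
if-%2-even n n%2≡0 rewrite n%2≡0 = refl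

if-%2-odd : ∀ {A : Set} n {x y : A} → n % 2 ≡ 1 → (if n % 2 ≡ᵇ 0 then x else y) ≡ y
if-%2-odd n n%2≡1 rewrite n%2≡1 = refl

a+b≡c⇒c∸a≡b : ∀ {a b c} → a + b ≡ c → c ∸ a ≡ b
a+b≡c⇒c∸a≡b {a} {b} refl = m+n∸m≡n a b

6r<2m⇒3r<m : ∀ {r m} → 6 * r < m * 2 → 3 * r < m
6r<2m⇒3r<m {r} {m} lt = *-cancelʳ-< 2 (3 * r) m (subst (_< m * 2) (lemma r) lt)
  where
  lemma : ∀ r → 6 * r ≡ 3 * r * 2
  lemma = solve-∀

tri-≡ : ∀ m {t} → m * suc m ≡ t * 2 → tri m ≡ t
tri-≡ m {t} eq = trans (cong (_/ 2) eq) (m*n/n≡m t 2)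

gcd-*-coprime : ∀ d {x y} → Coprime x y → gcd (d * x) (d * y) ≡ d
gcd-*-coprime d {x} {y} x⊥y = trans (sym (c*gcd[m,n]≡gcd[cm,cn] d x y)) (trans (cong (d *_) (coprime⇒gcd≡1 x⊥y)) (*-identityʳ d))

*÷-cancel : ∀ d .{{_ : NonZero d}} x → (d * x) ÷ d ≡ x
*÷-cancel (suc d) x = trans (cong (_/ suc d) (*-comm (suc d) x)) (m*n/n≡m x (suc d))

2⊥odd : ∀ m → Coprime 2 (suc (2 * m))
2⊥odd m {d} (d∣2 , d∣odd) = ∣1⇒≡1 (∣m+n∣m⇒∣n (subst (d ∣_) (+-comm 1 (2 * m)) d∣odd) (∣-trans d∣2 (m∣m*n m)))

pred[n]<n : ∀ {n} .{{_ : NonZero n}} → pred n < n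
pred[n]<n {suc n} = n<1+n n

boundary : ∀ {b c m W} .{{_ : NonZero b}} → m + (b + c) ≡ b * W + c * b → m + b ≡ b * W + c * pred b
boundary {b@(suc b′)} {c} {m} {W} eq = +-cancelʳ-≡ c _ _ (begin
  m + b + c           ≡⟨ +-assoc m b c ⟩
  m + (b + c)         ≡⟨ eq ⟩
  b * W + c * b       ≡⟨ lemma b W c b′ ⟩
  b * W + c * b′ + c  ∎)
  where
  open ≡-Reasoning
  lemma : ∀ b W c b′ → b * W + c * suc b′ ≡ b * W + c * b′ + c
  lemma = solve-∀

isFloorSqrt-k : ∀ {k i} → i < k → IsFloorSqrt k (k * (k + 1) + i + 1)
isFloorSqrt-k {k} {i} i<k = subst (k * k ≤_) (lemma₁ k i) (m≤m+n (k * k) (k + i + 1)) , (begin-strict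
  k * (k + 1) + i + 1  <⟨ +-monoˡ-< 1 (+-monoʳ-< (k * (k + 1)) i<k) ⟩
  k * (k + 1) + k + 1  ≡⟨ lemma₂ k ⟩
  suc k * suc k        ∎)
  where
  open ≤-Reasoning
  lemma₁ : ∀ k i → k * k + (k + i + 1) ≡ k * (k + 1) + i + 1
  lemma₁ = solve-∀
  lemma₂ : ∀ k → k * (k + 1) + k + 1 ≡ suc k * suc k
  lemma₂ = solve-∀

isFloorSqrt-k+1 : ∀ {k i} → k ≤ i → i ≤ 2 * k + 1 → IsFloorSqrt (suc k) (k * (k + 1) + i + 1)
isFloorSqrt-k+1 {k} {i} k≤i i≤2k+1 = (begin
  suc k * suc k        ≡⟨ lemma₁ k ⟩
  k * (k + 1) + k + 1  ≤⟨ +-monoˡ-≤ 1 (+-monoʳ-≤ (k * (k + 1)) k≤i) ⟩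
  k * (k + 1) + i + 1  ∎) , (begin-strict
  k * (k + 1) + i + 1              ≤⟨ +-monoˡ-≤ 1 (+-monoʳ-≤ (k * (k + 1)) i≤2k+1) ⟩
  k * (k + 1) + (2 * k + 1) + 1    <⟨ m<m+n _ 0<1+n ⟩
  k * (k + 1) + (2 * k + 1) + 1 + suc (suc k) ≡⟨ lemma₂ k ⟩
  suc (suc k) * suc (suc k)        ∎)
  where
  open ≤-Reasoning
  lemma₁ : ∀ k → suc k * suc k ≡ k * (k + 1) + k + 1
  lemma₁ = solve-∀
  lemma₂ : ∀ k → k * (k + 1) + (2 * k + 1) + 1 + suc (suc k) ≡ suc (suc k) * suc (suc k)
  lemma₂ = solve-∀

isFloorHalfSqrtMinus1-k : ∀ {k i} → i ≤ 2 * k → IsFloorHalfSqrtMinus1 k (4 * (k * (k + 1) + i) + 5)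
isFloorHalfSqrtMinus1-k {k} {i} i≤2k = subst ((1 + 2 * k) * (1 + 2 * k) ≤_) (lemma₁ k i) (m≤m+n _ (4 * i + 4)) , (begin-strict
  4 * (k * (k + 1) + i) + 5        ≤⟨ +-monoˡ-≤ 5 (*-monoʳ-≤ 4 (+-monoʳ-≤ (k * (k + 1)) i≤2k)) ⟩
  4 * (k * (k + 1) + 2 * k) + 5    <⟨ m<m+n _ 0<1+n ⟩
  4 * (k * (k + 1) + 2 * k) + 5 + 4 ≡⟨ lemma₂ k ⟩
  (3 + 2 * k) * (3 + 2 * k)        ∎)
  where
  open ≤-Reasoning
  lemma₁ : ∀ k i → (1 + 2 * k) * (1 + 2 * k) + (4 * i + 4) ≡ 4 * (k * (k + 1) + i) + 5
  lemma₁ = solve-∀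
  lemma₂ : ∀ k → 4 * (k * (k + 1) + 2 * k) + 5 + 4 ≡ (3 + 2 * k) * (3 + 2 * k)
  lemma₂ = solve-∀

isFloorHalfSqrtMinus1-k+1 : ∀ k → IsFloorHalfSqrtMinus1 (suc k) (4 * (k * (k + 1) + (2 * k + 1)) + 5)
isFloorHalfSqrtMinus1-k+1 k = ≤-reflexive (lemma₁ k) , (begin-strict
  4 * (k * (k + 1) + (2 * k + 1)) + 5            <⟨ m<m+n _ 0<1+n ⟩
  4 * (k * (k + 1) + (2 * k + 1)) + 5 + suc (8 * k + 15) ≡⟨ lemma₂ k ⟩
  (3 + 2 * suc k) * (3 + 2 * suc k)              ∎)
  where
  open ≤-Reasoning
  lemma₁ : ∀ k → (1 + 2 * suc k) * (1 + 2 * suc k) ≡ 4 * (k * (k + 1) + (2 * k + 1)) + 5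
  lemma₁ = solve-∀
  lemma₂ : ∀ k → 4 * (k * (k + 1) + (2 * k + 1)) + 5 + suc (8 * k + 15) ≡ (3 + 2 * suc k) * (3 + 2 * suc k)
  lemma₂ = solve-∀

module UpperRange {k i : ℕ} (k<i : k < i) (i≤2k+1 : i ≤ 2 * k + 1) where

  x : ℕ
  x = i ∸ suc k

  1+k+x≡i : suc k + x ≡ i
  1+k+x≡i = m+[n∸m]≡n k<i

  x≤k : x ≤ k
  x≤k = +-cancelˡ-≤ (suc k) x k (subst₂ _≤_ (sym 1+k+x≡i) (lemma k) i≤2k+1)
    where
    lemma : ∀ k → 2 * k + 1 ≡ suc k + k
    lemma = solve-∀

  i∸k∸1≡x : i ∸ k ∸ 1 ≡ x
  i∸k∸1≡x = trans (∸-+-assoc i k 1) (cong (i ∸_) (+-comm k 1))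

  d : ℕ
  d = k ∸ x

  x+d≡k : x + d ≡ k
  x+d≡k = m+[n∸m]≡n x≤k

  square+x≡s : suc k * suc k + x ≡ k * (k + 1) + i
  square+x≡s = trans (lemma k x) (cong (k * (k + 1) +_) 1+k+x≡i)
    where
    lemma : ∀ k x → suc k * suc k + x ≡ k * (k + 1) + (suc k + x)
    lemma = solve-∀

data EvenOdd : ℕ → Set where
  even : ∀ m → EvenOdd (m * 2)
  odd  : ∀ m → EvenOdd (suc (m * 2))

evenOdd : ∀ n → EvenOdd n
evenOdd zero          = even 0
evenOdd (suc zero)    = odd 0
evenOdd (suc (suc n)) with evenOdd n
... | even m = even (suc m)
... | odd  m = odd (suc m)

-- Opened only here: ℤ's prefix +_ makes the sections (m +_) used above ambiguous.
open import Data.Integer using (ℤ; +_; -[1+_]; _-_)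
import Data.Integer as ℤ
import Data.Integer.Properties as ℤ
import Data.Integer.Tactic.RingSolver as ℤ-Solver

isGenFrob-intro : ∀ L s N K → K ≤ suc N → (∀ m → m + K ≡ N → repsℕ L m ≤ s) →
                  (∀ m → N < m + K → s < repsℕ L m) → IsGenFrob L s (+ N - + K)
isGenFrob-intro L s N K K≤1+N at above with K ≤? N
... | yes K≤N = subst (IsGenFrob L s) (sym F≡N∸K) (at (N ∸ K) (m∸n+n≡m K≤N) , beyond)
  where
  F≡N∸K : + N - + K ≡ + (N ∸ K)
  F≡N∸K = trans (ℤ.[+m]-[+n]≡m⊖n N K) (ℤ.⊖-≥ K≤N)
  beyond : ∀ m → + (N ∸ K) ℤ.< m → s < reps L m
  beyond (+ m) (ℤ.+<+ N∸K<m) = above m (subst (_< m + K) (m∸n+n≡m K≤N) (+-monoˡ-< K N∸K<m))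
... | no K≰N = subst (IsGenFrob L s) (sym F≡-1) (z≤n , beyond)
  where
  K≡1+N : K ≡ suc N
  K≡1+N = ≤-antisym K≤1+N (≰⇒> K≰N)
  F≡-1 : + N - + K ≡ -[1+ 0 ]
  F≡-1 = trans (ℤ.[+m]-[+n]≡m⊖n N K) (trans (ℤ.⊖-< (≰⇒> K≰N)) (cong (λ d → ℤ.- + d) (trans (cong (_∸ N) K≡1+N) (m+n∸n≡m 1 N))))
  beyond : ∀ m → -[1+ 0 ] ℤ.< m → s < reps L m
  beyond (+ m) ℤ.-<+ = above m (subst (N <_) (+-comm K m) (≤-trans (≤-reflexive (sym K≡1+N)) (m≤m+n K m)))

isGenFrob-criterion : ∀ L {b c s W} .{{_ : NonZero b}} .{{_ : NonZero c}} → Coprime b c →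
  (∀ m → repsℕ L m ≤ repsℕ L (m + b)) →
  (∀ m → m + (b + c) ≡ b * W + c * b → repsℕ L m ≤ s) →
  (∀ m z → z < b → m + b ≡ b * suc W + c * z → s < repsℕ L m) →
  IsGenFrob L s (+ (b * W + c * b) - + (b + c))
isGenFrob-criterion L {b@(suc b′)} {c@(suc c′)} {s} {W} b⊥c mono at next =
  isGenFrob-intro L s (b * W + c * b) (b + c) b+c≤1+F at (reps-above L b⊥c mono next)
  where
  lemma : ∀ b′ c′ → suc (suc c′ * suc b′) ≡ suc b′ + suc c′ + c′ * b′
  lemma = solve-∀
  b+c≤1+F : b + c ≤ suc (b * W + c * b)
  b+c≤1+F = ≤-trans (m≤m+n (b + c) (c′ * b′)) (≤-trans (≤-reflexive (sym (lemma b′ c′))) (s≤s (m≤n+m (c * b) (b * W))))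

FrobeniusPair : (a b c x y s : ℕ) → Set
FrobeniusPair a b c x y s = IsGenFrob (a ∷ b ∷ c ∷ []) s F × IsGenFrob (b ∷ c ∷ []) x (F - + y ℤ.* + a)
  where
  F = ((+ x ℤ.+ + 1) ℤ.* (+ c ℤ.* + b)) - + c - + b ℤ.+ + y ℤ.* + a

pairValue : ∀ b c x → + (b * (x * c) + c * b) - + (b + c) ≡ ((+ x ℤ.+ + 1) ℤ.* (+ c ℤ.* + b)) - + c - + b
pairValue b c x = begin
  + (b * (x * c) + c * b) - + (b + c)
    ≡⟨ cong₂ (λ u v → u ℤ.+ v - + (b + c)) (trans (ℤ.pos-* b (x * c)) (cong (+ b ℤ.*_) (ℤ.pos-* x c))) (ℤ.pos-* c b) ⟩
  + b ℤ.* (+ x ℤ.* + c) ℤ.+ + c ℤ.* + b - (+ b ℤ.+ + c)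
    ≡⟨ lemma (+ b) (+ c) (+ x) ⟩
  ((+ x ℤ.+ + 1) ℤ.* (+ c ℤ.* + b)) - + c - + b ∎
  where
  open ≡-Reasoning
  lemma : ∀ b c x → b ℤ.* (x ℤ.* c) ℤ.+ c ℤ.* b - (b ℤ.+ c) ≡ ((x ℤ.+ ℤ.1ℤ) ℤ.* (c ℤ.* b)) - c - b
  lemma = ℤ-Solver.solve-∀

module _ {b c q : ℕ} .{{_ : NonZero b}} .{{_ : NonZero c}} .{{_ : NonZero q}} (b⊥c : Coprime b c) where
  open Pair b c b⊥c
  open Triple b c q b⊥c

  frobeniusPair : ∀ {x y s} u e → e < q → u * q + e ≡ x * c + y * q → ceilSum c q e u ≡ s → ceilSum c q (suc e) u ≡ suc s →
                  FrobeniusPair (q * b) b c x y s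
  frobeniusPair {x} {y} {s} u e e<q uq+e≡xc+yq ceilSum≡s ceilSum≡1+s =
    subst (IsGenFrob (q * b ∷ b ∷ c ∷ []) s) F≡ triple , subst (IsGenFrob (b ∷ c ∷ []) x) G≡ pair
    where
    open ≡-Reasoning
    mono-pair : ∀ m → repsℕ (b ∷ c ∷ []) m ≤ repsℕ (b ∷ c ∷ []) (m + b)
    mono-pair = reps-cons-≤-+ b (c ∷ [])
    triple : IsGenFrob (q * b ∷ b ∷ c ∷ []) s (+ (b * (u * q + e) + c * b) - + (b + c))
    triple = isGenFrob-criterion _ b⊥c (reps-cons-mono (q * b) (b ∷ c ∷ []) b mono-pair)
      (λ m eq → ≤-reflexive (trans (reps-triple u (<⇒≤ e<q) (pred[n]<n {b}) (boundary eq)) ceilSum≡s))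
      (λ m z z<b eq → ≤-reflexive (sym (trans (reps-triple u e<q z<b (trans eq (cong (λ w → b * w + c * z) (sym (+-suc (u * q) e))))) ceilSum≡1+s)))
    pair : IsGenFrob (b ∷ c ∷ []) x (+ (b * (x * c) + c * b) - + (b + c))
    pair = isGenFrob-criterion _ b⊥c mono-pair
      (λ m eq → ≤-reflexive (trans (reps-pair (x * c) (pred[n]<n {b}) (boundary eq)) (multiplesBelow-* c x)))
      (λ m z z<b eq → ≤-reflexive (sym (trans (reps-pair (suc (x * c)) z<b eq) (multiplesBelow-*+1 c x))))
    G Y : ℤ
    G = ((+ x ℤ.+ + 1) ℤ.* (+ c ℤ.* + b)) - + c - + b
    Y = + y ℤ.* + (q * b)
    G≡ : + (b * (x * c) + c * b) - + (b + c) ≡ G ℤ.+ Y - Y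
    G≡ = trans (pairValue b c x) (lemma G Y)
      where
      lemma : ∀ G Y → G ≡ G ℤ.+ Y - Y
      lemma = ℤ-Solver.solve-∀
    F≡ : + (b * (u * q + e) + c * b) - + (b + c) ≡ G ℤ.+ Y
    F≡ = begin
      + (b * (u * q + e) + c * b) - + (b + c)            ≡⟨ cong (λ w → + (b * w + c * b) - + (b + c)) uq+e≡xc+yq ⟩
      + (b * (x * c + y * q) + c * b) - + (b + c)        ≡⟨ cong (λ w → + w - + (b + c)) (lemma b x c y q) ⟩
      + (b * (x * c) + c * b) ℤ.+ + (y * (q * b)) - + (b + c) ≡⟨ lemma₂ (+ (b * (x * c) + c * b)) (+ (y * (q * b))) (+ (b + c)) ⟩
      + (b * (x * c) + c * b) - + (b + c) ℤ.+ + (y * (q * b)) ≡⟨ cong₂ ℤ._+_ (pairValue b c x) (ℤ.pos-* y (q * b)) ⟩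
      G ℤ.+ Y                                            ∎
      where
      lemma : ∀ b x c y q → b * (x * c + y * q) + c * b ≡ b * (x * c) + c * b + y * (q * b)
      lemma = solve-∀
      lemma₂ : ∀ P Q K → P ℤ.+ Q - K ≡ P - K ℤ.+ Q
      lemma₂ = ℤ-Solver.solve-∀

6r-d<n⇒6r<n+d : ∀ r {d n} → (+ 6 ℤ.* + r) - + d ℤ.< + n → 6 * r < n + d
6r-d<n⇒6r<n+d r {d} {n} lt with d ≤? 6 * r
... | yes d≤6r = subst (_< n + d) (m∸n+n≡m d≤6r) (+-monoˡ-< d (ℤ.drop‿+<+ (subst (ℤ._< + n) F≡ lt)))
  where
  F≡ : (+ 6 ℤ.* + r) - + d ≡ + (6 * r ∸ d)
  F≡ = trans (cong (λ z → z - + d) (sym (ℤ.pos-* 6 r))) (trans (ℤ.[+m]-[+n]≡m⊖n (6 * r) d) (ℤ.⊖-≥ d≤6r))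
... | no d≰6r = ≤-trans (≰⇒> d≰6r) (m≤n+m d n)

frobeniusPair-tri : ∀ n d {a b c x y s k i} .{{_ : NonZero d}} → Coprime b c →
  tri n ≡ a → tri (n + 1) ≡ d * b → tri (n + 2) ≡ d * c → xS n k i ≡ x → yS n k i ≡ y →
  FrobeniusPair a b c x y s →
  FrobeniusPair (tri n) (tri (n + 1) ÷ gcd (tri (n + 1)) (tri (n + 2))) (tri (n + 2) ÷ gcd (tri (n + 1)) (tri (n + 2)))
                (xS n k i) (yS n k i) s
frobeniusPair-tri n d {b = b} {c} b⊥c refl t₁ t₂ refl refl p
  rewrite t₁ | t₂ | gcd-*-coprime d b⊥c | *÷-cancel d b | *÷-cancel d c = p

module EvenCase (M : ℕ) .{{_ : NonZero M}} where
  open EvenSums M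

  b : ℕ
  b = suc (2 * M)

  b⊥c : Coprime b c
  b⊥c = Coprimality.sym (coprime-+ (2⊥odd M))

  frobenius-lower : ∀ {k i} → i ≤ k → 3 * i < M → 3 * k < M + 3 →
                    FrobeniusPair (M * b) b c (xEven k i) (yEven k i) (k * (k + 1) + i)
  frobenius-lower {k} {i} i≤k 3i<M 3k<M+3 =
    frobeniusPair b⊥c {xEven k i} {yEven k i} {k * (k + 1) + i} (2 * k) (3 * i) 3i<M linear
      (ceilSum-even k (3 * i) i (<⇒≤ 3i<M) 3k<M+3 (λ t → χ-3* t i) (≤-trans i≤k (n≤1+n k)))
      (trans (ceilSum-even k (suc (3 * i)) (suc i) 3i<M 3k<M+3 (λ t → χ-3*+1 t i) (s≤s i≤k)) (+-suc _ i))
    where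
    open ≡-Reasoning
    d = k ∸ i
    lemma : ∀ i d M → 2 * (i + d) * M + 3 * i ≡ i * (suc (2 * M) + 2) + 2 * d * M
    lemma = solve-∀
    linear : 2 * k * M + 3 * i ≡ xEven k i * c + yEven k i * M
    linear = begin
      2 * k * M + 3 * i              ≡⟨ cong (λ κ → 2 * κ * M + 3 * i) (m+[n∸m]≡n i≤k) ⟨
      2 * (i + d) * M + 3 * i        ≡⟨ lemma i d M ⟩
      i * c + 2 * d * M              ≡⟨ cong₂ (λ x y → x * c + y * M) (if-≤ᵇ i≤k) (if-≤ᵇ i≤k) ⟨
      xEven k i * c + yEven k i * M  ∎

  frobenius-upper : ∀ {k i} → k < i → i ≤ 2 * k + 1 → 3 * k < M →
                    FrobeniusPair (M * b) b c (xEven k i) (yEven k i) (k * (k + 1) + i)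
  frobenius-upper {k} {i} k<i i≤2k+1 3k<M =
    frobeniusPair b⊥c {xEven k i} {yEven k i} {k * (k + 1) + i} (suc (2 * k)) (3 * x) 3x<M linear
      (trans (ceilSum-even-suc k (3 * x) x (<⇒≤ 3x<M) 3k<M (λ t → χ-3* t x) (≤-trans x≤k (n≤1+n k))) square+x≡s)
      (trans (ceilSum-even-suc k (suc (3 * x)) (suc x) 3x<M 3k<M (λ t → χ-3*+1 t x) (s≤s x≤k))
             (trans (+-suc _ x) (cong suc square+x≡s)))
    where
    open UpperRange k<i i≤2k+1
    open ≡-Reasoning
    3x<M : 3 * x < M
    3x<M = ≤-<-trans (*-monoʳ-≤ 3 x≤k) 3k<M
    lemma : ∀ x d → 2 * (suc (x + d) + x) + (2 * d + 1) ≡ 4 * (x + d) + 3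
    lemma = solve-∀
    y≡ : yEven k i ≡ 2 * d + 1
    y≡ = trans (if-≰ᵇ k<i) (a+b≡c⇒c∸a≡b {2 * i} (begin
      2 * i + (2 * d + 1)                  ≡⟨ cong (λ ι → 2 * ι + (2 * d + 1)) 1+k+x≡i ⟨
      2 * (suc k + x) + (2 * d + 1)        ≡⟨ cong (λ κ → 2 * (suc κ + x) + (2 * d + 1)) x+d≡k ⟨
      2 * (suc (x + d) + x) + (2 * d + 1)  ≡⟨ lemma x d ⟩
      4 * (x + d) + 3                      ≡⟨ cong (λ κ → 4 * κ + 3) x+d≡k ⟩
      4 * k + 3                            ∎))
    lemma₂ : ∀ x d M → suc (2 * (x + d)) * M + 3 * x ≡ x * (suc (2 * M) + 2) + (2 * d + 1) * M
    lemma₂ = solve-∀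
    linear : suc (2 * k) * M + 3 * x ≡ xEven k i * c + yEven k i * M
    linear = begin
      suc (2 * k) * M + 3 * x        ≡⟨ cong (λ κ → suc (2 * κ) * M + 3 * x) x+d≡k ⟨
      suc (2 * (x + d)) * M + 3 * x  ≡⟨ lemma₂ x d M ⟩
      x * c + (2 * d + 1) * M        ≡⟨ cong₂ (λ x y → x * c + y * M) (trans (if-≰ᵇ k<i) i∸k∸1≡x) y≡ ⟨
      xEven k i * c + yEven k i * M  ∎

  frobenius : ∀ k i → i ≤ 2 * k + 1 → (∀ r → IsFloorSqrt r (k * (k + 1) + i + 1) → 3 * r < M + 3) →
              FrobeniusPair (M * b) b c (xEven k i) (yEven k i) (k * (k + 1) + i)
  frobenius k i i≤2k+1 bound with <-cmp i k
  ... | tri< i<k _ _ = frobenius-lower {k} {i} (<⇒≤ i<k) (3[1+t]<x+3⇒3t<x (≤-<-trans (*-monoʳ-≤ 3 i<k) 3k<M+3)) 3k<M+3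
    where
    3k<M+3 : 3 * k < M + 3
    3k<M+3 = bound k (isFloorSqrt-k i<k)
  ... | tri≈ _ refl _ = frobenius-lower {i} {i} ≤-refl 3k<M (<-≤-trans 3k<M (m≤m+n M 3))
    where
    3k<M : 3 * i < M
    3k<M = 3[1+t]<x+3⇒3t<x (bound (suc i) (isFloorSqrt-k+1 ≤-refl i≤2k+1))
  ... | tri> _ _ k<i = frobenius-upper {k} {i} k<i i≤2k+1 (3[1+t]<x+3⇒3t<x (bound (suc k) (isFloorSqrt-k+1 (<⇒≤ k<i) i≤2k+1)))

  tri-n : tri (M * 2) ≡ M * b
  tri-n = tri-≡ (M * 2) (lemma M)
    where
    lemma : ∀ M → M * 2 * suc (M * 2) ≡ M * suc (2 * M) * 2
    lemma = solve-∀

  tri-n+1 : tri (M * 2 + 1) ≡ suc M * b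
  tri-n+1 = tri-≡ (M * 2 + 1) (lemma M)
    where
    lemma : ∀ M → (M * 2 + 1) * suc (M * 2 + 1) ≡ suc M * suc (2 * M) * 2
    lemma = solve-∀

  tri-n+2 : tri (M * 2 + 2) ≡ suc M * c
  tri-n+2 = tri-≡ (M * 2 + 2) (lemma M)
    where
    lemma : ∀ M → (M * 2 + 2) * suc (M * 2 + 2) ≡ suc M * (suc (2 * M) + 2) * 2
    lemma = solve-∀

  floor-bound : ∀ {r} → (+ 6 ℤ.* + r) - + 6 ℤ.< + (M * 2) → 3 * r < M + 3
  floor-bound {r} lt = 6r<2m⇒3r<m {r} (subst (6 * r <_) (lemma M) (6r-d<n⇒6r<n+d r lt))
    where
    lemma : ∀ M → M * 2 + 6 ≡ (M + 3) * 2
    lemma = solve-∀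

module OddCase (M : ℕ) where
  open OddSums M public

  b : ℕ
  b = suc M

  b⊥c : Coprime b c
  b⊥c = Coprimality.sym (coprime-+ (Coprimality.1-coprimeTo b))

  3i<c⇒3i<q : ∀ {i} → 3 * i < c → 3 * i < q
  3i<c⇒3i<q {zero}  _    = s≤s z≤n
  3i<c⇒3i<q {suc i} 3i<c = s≤s (≤-trans 3i≤M+1 (≤-trans (+-monoʳ-≤ M 1≤M) (≤-reflexive (lemma M))))
    where
    3i≤M+1 : 3 * suc i ≤ M + 1
    3i≤M+1 = ≤-pred 3i<c
    1≤M : 1 ≤ M
    1≤M = ≤-trans (s≤s z≤n) (+-cancelʳ-≤ 1 2 M (≤-trans (m≤m*n 3 (suc i)) 3i≤M+1))
    lemma : ∀ M → M + M ≡ 2 * M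
    lemma = solve-∀

  frobenius-lower : ∀ {k i} → i ≤ k → 3 * k < c →
                    FrobeniusPair (q * b) b c (xOdd k i) (yOdd k i) (k * (k + 1) + i)
  frobenius-lower {k} {i} i≤k 3k<c =
    frobeniusPair b⊥c {xOdd k i} {yOdd k i} {k * (k + 1) + i} k (3 * i) (3i<c⇒3i<q {i} 3i<c) linear
      (ceilSum-odd k (3 * i) i (<⇒≤ 3i<c) 3k<c (λ j → χ-3* j i) (≤-trans i≤k (n≤1+n k)))
      (trans (ceilSum-odd k (suc (3 * i)) (suc i) 3i<c 3k<c (λ j → χ-3*+1 j i) (s≤s i≤k)) (+-suc _ i))
    where
    open ≡-Reasoning
    3i<c : 3 * i < c
    3i<c = ≤-<-trans (*-monoʳ-≤ 3 i≤k) 3k<c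
    d = k ∸ i
    lemma : ∀ i d M → (i + d) * suc (2 * M) + 3 * i ≡ 2 * i * (suc M + 1) + d * suc (2 * M)
    lemma = solve-∀
    linear : k * q + 3 * i ≡ xOdd k i * c + yOdd k i * q
    linear = begin
      k * q + 3 * i                ≡⟨ cong (λ κ → κ * q + 3 * i) (m+[n∸m]≡n i≤k) ⟨
      (i + d) * q + 3 * i          ≡⟨ lemma i d M ⟩
      2 * i * c + d * q            ≡⟨ cong₂ (λ x y → x * c + y * q) (if-≤ᵇ i≤k) (if-≤ᵇ i≤k) ⟨
      xOdd k i * c + yOdd k i * q  ∎

  frobenius-upper : ∀ {k i} → k < i → i ≤ 2 * k + 1 → 3 * k < c → 3 * i < 3 * k + c →
                    FrobeniusPair (q * b) b c (xOdd k i) (yOdd k i) (k * (k + 1) + i)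
  frobenius-upper {k} {i} k<i i≤2k+1 3k<c 3i<3k+c =
    frobeniusPair b⊥c {xOdd k i} {yOdd k i} {k * (k + 1) + i} k (3 * x + c) e<q linear
      (trans (ceilSum-odd-+c k (3 * x) x (<⇒≤ 3x<c) 3k<c (λ j → χ-3* j x) (≤-trans x≤k (n≤1+n k))) square+x≡s)
      (trans (ceilSum-odd-+c k (suc (3 * x)) (suc x) 3x<c 3k<c (λ j → χ-3*+1 j x) (s≤s x≤k))
             (trans (+-suc _ x) (cong suc square+x≡s)))
    where
    open UpperRange k<i i≤2k+1
    open ≡-Reasoning
    lemma : ∀ k x → 3 * (suc k + x) ≡ 3 * k + 3 * suc x
    lemma = solve-∀
    3[1+x]<c : 3 * suc x < c
    3[1+x]<c = +-cancelˡ-< (3 * k) _ c (subst (_< 3 * k + c) (trans (cong (3 *_) (sym 1+k+x≡i)) (lemma k x)) 3i<3k+c)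
    3x<c : 3 * x < c
    3x<c = ≤-<-trans (*-monoʳ-≤ 3 (n≤1+n x)) 3[1+x]<c
    3x+2≤M : 3 * x + 2 ≤ M
    3x+2≤M = +-cancelʳ-≤ 1 (3 * x + 2) M (subst (_≤ M + 1) (lemma₂ x) (≤-pred 3[1+x]<c))
      where
      lemma₂ : ∀ x → 3 * suc x ≡ 3 * x + 2 + 1
      lemma₂ = solve-∀
    e<q : 3 * x + c < q
    e<q = s≤s (≤-trans (≤-reflexive (lemma₂ x M)) (≤-trans (+-monoˡ-≤ M 3x+2≤M) (≤-reflexive (lemma₃ M))))
      where
      lemma₂ : ∀ x M → 3 * x + (suc M + 1) ≡ 3 * x + 2 + M
      lemma₂ = solve-∀
      lemma₃ : ∀ M → M + M ≡ 2 * M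
      lemma₃ = solve-∀
    x≡ : xOdd k i ≡ 2 * x + 1
    x≡ = trans (if-≰ᵇ k<i) (trans (cong (λ y → 2 * y ∸ 1) (a+b≡c⇒c∸a≡b {k} (trans (+-suc k x) 1+k+x≡i))) (a+b≡c⇒c∸a≡b {1} (lemma₂ x)))
      where
      lemma₂ : ∀ x → 1 + (2 * x + 1) ≡ 2 * suc x
      lemma₂ = solve-∀
    y≡ : yOdd k i ≡ d
    y≡ = trans (if-≰ᵇ k<i) (a+b≡c⇒c∸a≡b {i} (begin
      i + d                  ≡⟨ cong (_+ d) 1+k+x≡i ⟨
      suc k + x + d          ≡⟨ cong (λ κ → suc κ + x + d) x+d≡k ⟨
      suc (x + d) + x + d    ≡⟨ lemma₂ x d ⟩
      2 * (x + d) + 1        ≡⟨ cong (λ κ → 2 * κ + 1) x+d≡k ⟩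
      2 * k + 1              ∎))
      where
      lemma₂ : ∀ x d → suc (x + d) + x + d ≡ 2 * (x + d) + 1
      lemma₂ = solve-∀
    lemma₃ : ∀ x d M → (x + d) * suc (2 * M) + (3 * x + (suc M + 1)) ≡ (2 * x + 1) * (suc M + 1) + d * suc (2 * M)
    lemma₃ = solve-∀
    linear : k * q + (3 * x + c) ≡ xOdd k i * c + yOdd k i * q
    linear = begin
      k * q + (3 * x + c)              ≡⟨ cong (λ κ → κ * q + (3 * x + c)) x+d≡k ⟨
      (x + d) * q + (3 * x + c)        ≡⟨ lemma₃ x d M ⟩
      (2 * x + 1) * c + d * q          ≡⟨ cong₂ (λ x y → x * c + y * q) x≡ y≡ ⟨
      xOdd k i * c + yOdd k i * q      ∎

  frobenius-≤2k : ∀ {k i} → i ≤ 2 * k → 3 * k < c →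
                  FrobeniusPair (q * b) b c (xOdd k i) (yOdd k i) (k * (k + 1) + i)
  frobenius-≤2k {k} {i} i≤2k 3k<c with i ≤? k
  ... | yes i≤k = frobenius-lower {k} {i} i≤k 3k<c
  ... | no  i≰k = frobenius-upper {k} {i} (≰⇒> i≰k) (≤-trans i≤2k (m≤m+n (2 * k) 1)) 3k<c 3i<3k+c
    where
    lemma : ∀ k → 3 * (2 * k) ≡ 3 * k + 3 * k
    lemma = solve-∀
    3i<3k+c : 3 * i < 3 * k + c
    3i<3k+c = ≤-<-trans (≤-trans (*-monoʳ-≤ 3 i≤2k) (≤-reflexive (lemma k))) (+-monoʳ-< (3 * k) 3k<c)

  frobenius : ∀ k i → i ≤ 2 * k + 1 → (∀ r → IsFloorHalfSqrtMinus1 r (4 * (k * (k + 1) + i) + 5) → 3 * r < c) →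
              FrobeniusPair (q * b) b c (xOdd k i) (yOdd k i) (k * (k + 1) + i)
  frobenius k i i≤2k+1 bound with i ≤? 2 * k
  ... | yes i≤2k = frobenius-≤2k {k} {i} i≤2k (bound k (isFloorHalfSqrtMinus1-k {k} i≤2k))
  ... | no  i≰2k = frobenius-upper {k} {i} k<i i≤2k+1 (≤-<-trans (*-monoʳ-≤ 3 (n≤1+n k)) 3[1+k]<c) 3i<3k+c
    where
    i≡2k+1 : i ≡ 2 * k + 1
    i≡2k+1 = ≤-antisym i≤2k+1 (subst (_≤ i) (+-comm 1 (2 * k)) (≰⇒> i≰2k))
    3[1+k]<c : 3 * suc k < c
    3[1+k]<c = bound (suc k) (subst (λ ι → IsFloorHalfSqrtMinus1 (suc k) (4 * (k * (k + 1) + ι) + 5)) (sym i≡2k+1)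
                                    (isFloorHalfSqrtMinus1-k+1 k))
    k<i : k < i
    k<i = ≤-<-trans (m≤m+n k (k + 0)) (≰⇒> i≰2k)
    lemma : ∀ k → 3 * (2 * k + 1) ≡ 3 * k + 3 * suc k
    lemma = solve-∀
    3i<3k+c : 3 * i < 3 * k + c
    3i<3k+c = subst (_< 3 * k + c) (sym (trans (cong (3 *_) i≡2k+1) (lemma k))) (+-monoʳ-< (3 * k) 3[1+k]<c)

  tri-n : tri (suc (M * 2)) ≡ q * b
  tri-n = tri-≡ (suc (M * 2)) (lemma M)
    where
    lemma : ∀ M → suc (M * 2) * suc (suc (M * 2)) ≡ suc (2 * M) * suc M * 2
    lemma = solve-∀

  tri-n+1 : tri (suc (M * 2) + 1) ≡ (q + 2) * b
  tri-n+1 = tri-≡ (suc (M * 2) + 1) (lemma M)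
    where
    lemma : ∀ M → (suc (M * 2) + 1) * suc (suc (M * 2) + 1) ≡ (suc (2 * M) + 2) * suc M * 2
    lemma = solve-∀

  tri-n+2 : tri (suc (M * 2) + 2) ≡ (q + 2) * c
  tri-n+2 = tri-≡ (suc (M * 2) + 2) (lemma M)
    where
    lemma : ∀ M → (suc (M * 2) + 2) * suc (suc (M * 2) + 2) ≡ (suc (2 * M) + 2) * (suc M + 1) * 2
    lemma = solve-∀

  floor-bound : ∀ {r} → (+ 6 ℤ.* + r) - + 3 ℤ.< + suc (M * 2) → 3 * r < c
  floor-bound {r} lt = 6r<2m⇒3r<m {r} (subst (6 * r <_) (lemma M) (6r-d<n⇒6r<n+d r lt))
    where
    lemma : ∀ M → suc (M * 2) + 3 ≡ (suc M + 1) * 2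
    lemma = solve-∀

theorem2p8 : (k i s n : ℕ) → s ≡ k * (k + 1) + i → i ≤ 2 * k + 1 → 1 ≤ n →
    (n % 2 ≡ 0 → ∀ r → IsFloorSqrt r (s + 1) → (+ 6 ℤ.* + r) - + 6 ℤ.< + n) →
    (n % 2 ≡ 1 → ∀ r → IsFloorHalfSqrtMinus1 r (4 * s + 5) → (+ 6 ℤ.* + r) - + 3 ℤ.< + n) →
    let d₁ = gcd (tri (n + 1)) (tri (n + 2))
        b = tri (n + 1) ÷ d₁
        c = tri (n + 2) ÷ d₁
        F = ((+ xS n k i ℤ.+ + 1) ℤ.* (+ c ℤ.* + b)) - + c - + b ℤ.+ + yS n k i ℤ.* + tri n
    in IsGenFrob (tri n ∷ b ∷ c ∷ []) s F
       × IsGenFrob (b ∷ c ∷ []) (xS n k i) (F - + yS n k i ℤ.* + tri n)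
theorem2p8 k i _ n refl i≤2k+1 1≤n even-bound odd-bound with evenOdd n
theorem2p8 k i _ _ refl i≤2k+1 () even-bound odd-bound | even zero
... | even M@(suc _) =
  frobeniusPair-tri (M * 2) (suc M) {k = k} {i = i} b⊥c tri-n tri-n+1 tri-n+2
    (if-%2-even (M * 2) n%2≡0) (if-%2-even (M * 2) n%2≡0)
    (frobenius k i i≤2k+1 (λ r floor → floor-bound {r} (even-bound n%2≡0 r floor)))
  where
  open EvenCase M
  n%2≡0 : M * 2 % 2 ≡ 0
  n%2≡0 = m*n%n≡0 M 2
... | odd M =
  frobeniusPair-tri (suc (M * 2)) (q + 2) {k = k} {i = i} b⊥c tri-n tri-n+1 tri-n+2
    (if-%2-odd (suc (M * 2)) n%2≡1) (if-%2-odd (suc (M * 2)) n%2≡1)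
    (frobenius k i i≤2k+1 (λ r floor → floor-bound {r} (odd-bound n%2≡1 r floor)))
  where
  open OddCase M
  n%2≡1 : suc (M * 2) % 2 ≡ 1
  n%2≡1 = [m+kn]%n≡m%n 1 M 2
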